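{- Let $n\ge 4$. Let $\mathscr{M}_{2,m}$ denote the set of isomorphism classes of matroids of rank $2$ on $[m]$, and let $\rho(n)$ denote the number of unordered sums of positive integers equal to $n$ all of whose summands are at least $2$ (i.e. the number of partitions of $n$ into parts $\ge 2$). Then $$|\mathscr{M}_{2,n}|=2|\mathscr{M}_{2,n-1}|-|\mathscr{M}_{2,n-2}|+\rho(n).$$
   Context: Two matroids on $[m]$ are isomorphic if some permutation of $[m]$ maps the bases of one bijectively onto the bases of the other. -}

module Defs where

open import Data.Nat using (ℕ; _≤_; _≥_)
open import Data.Bool using (Bool; true)
open import Data.Fin using (Fin)
open import Data.Fin.Subset using (Subset; _∈_; _∉_; _∪_; _-_; ⁅_⁆; ∣_∣)
open import Data.Fin.Permutation using (Permutation′; _⟨$⟩ˡ_)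
open import Data.Vec using (tabulate; lookup)
open import Data.List using (List)
open import Data.Nat.ListAction using (sum)
open import Data.List.Relation.Unary.All using (All)
open import Data.List.Relation.Unary.AllPairs using (AllPairs)
open import Data.List.Relation.Unary.Unique.Propositional using (Unique)
open import Data.List.Membership.Propositional using () renaming (_∈_ to _∈ₗ_)
open import Data.List.Relation.Unary.Any using (Any)
open import Data.Product using (Σ; ∃; _×_)
open import Relation.Binary.PropositionalEquality using (_≡_)
open import Relation.Nullary using (¬_)

record Matroid (m : ℕ) : Set where
  field
    isBasis  : Subset m → Bool
    nonempty : ∃ λ B → isBasis B ≡ true
    exchange : ∀ B₁ B₂ → isBasis B₁ ≡ true → isBasis B₂ ≡ true →
               ∀ x → x ∈ B₁ → x ∉ B₂ →
               ∃ λ y → y ∈ B₂ × y ∉ B₁ × isBasis ((B₁ - x) ∪ ⁅ y ⁆) ≡ true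

open Matroid public

HasRank : ∀ {m} → ℕ → Matroid m → Set
HasRank r M = ∀ B → isBasis M B ≡ true → ∣ B ∣ ≡ r

-- image of a subset under a permutation σ of [m]:  j ∈ σ(X) ⇔ σ⁻¹ j ∈ X
image : ∀ {m} → Permutation′ m → Subset m → Subset m
image σ X = tabulate (λ j → lookup X (σ ⟨$⟩ˡ j))

Isomorphic : ∀ {m} → Matroid m → Matroid m → Set
Isomorphic M N = ∃ λ σ → ∀ X → isBasis M X ≡ isBasis N (image σ X)

-- A list of rank-2 matroids on [m] forming a complete, irredundant system
-- of representatives of the isomorphism classes of rank-2 matroids on [m].
-- Its length is |𝓜_{2,m}|.
IsRank2ClassReps : (m : ℕ) → List (Matroid m) → Set
IsRank2ClassReps m L =
  All (HasRank 2) L ×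
  AllPairs (λ M N → ¬ Isomorphic M N) L ×
  (∀ (M : Matroid m) → HasRank 2 M → Any (Isomorphic M) L)

data NonIncreasing : List ℕ → Set where
  []  : NonIncreasing Data.List.[]
  [_] : ∀ x → NonIncreasing (x Data.List.∷ Data.List.[])
  _∷_ : ∀ {x y xs} → x ≥ y → NonIncreasing (y Data.List.∷ xs) →
        NonIncreasing (x Data.List.∷ y Data.List.∷ xs)

IsPartition≥2 : ℕ → List ℕ → Set
IsPartition≥2 n xs = NonIncreasing xs × All (2 ≤_) xs × sum xs ≡ n

-- A duplicate-free list enumerating exactly the partitions of n into
-- parts ≥ 2; its length is ρ(n).
IsPartition≥2Enum : ℕ → List (List ℕ) → Set
IsPartition≥2Enum n P =
  Unique P × (∀ xs → xs ∈ₗ P → IsPartition≥2 n xs) ×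
  (∀ xs → IsPartition≥2 n xs → xs ∈ₗ P)

-- The bases of a rank-2 matroid are the pairs of non-loops in different parallel classes, so up
-- to isomorphism it is determined by its number of loops and the multiset of sizes of its (at
-- least two) parallel classes.  We encode it as a colouring (loops uncoloured, one colour per
-- parallel class), move every colouring into a canonical layout by a permutation built one
-- element at a time, and recover the loops and class sizes from counts that permutations
-- preserve.  Hence |𝓜₂,ₘ| − |𝓜₂,ₘ₋₁| = q(m), the number of partitions of m into at least two
-- parts, and q(n) − q(n − 1) = ρ(n): deleting a part 1 matches the partitions of n having a
-- part 1 with those of n − 1, and the others are the ρ(n) partitions into parts ≥ 2 except [n].

module Submission where

import Data.Nat.Properties as ℕ
open import Algebra.Properties.CommutativeMonoid.Sum ℕ.+-0-commutativeMonoid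
  using (sum-permute; sum-remove; sum-cong-≗) renaming (sum to ∑)
open import Data.Bool using (Bool; true; false)
import Data.Bool.Properties as Bool
open import Data.Empty using (⊥; ⊥-elim)
open import Data.Fin using (Fin; zero; suc; toℕ; punchIn; punchOut; fromℕ<; _≟_)
open import Data.Fin.Permutation using (Permutation′; _⟨$⟩ˡ_; _⟨$⟩ʳ_; inverseˡ; inverseʳ; _∘ₚ_; insert; insert-punchIn)
import Data.Fin.Permutation as Perm
open import Data.Fin.Properties using (any?; toℕ-injective; suc-injective; punchIn-punchOut)
open import Data.Fin.Subset using (Subset; _∈_; _∉_; _∪_; _─_; _-_; ⁅_⁆; ∣_∣; _⊆_) renaming (⊥ to ∅)
open import Data.Fin.Subset.Properties
  using (⊆-antisym; x∈⁅x⁆; x∈⁅y⁆⇒x≡y; x∈p∪q⁻; x∈p∪q⁺; p─q⊆p; x∈p∧x≢y⇒x∈p-y; ∪-comm; ∪-idem; ∪-identityˡ; ∣⁅x⁆∣≡1; _∈?_)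
open import Data.List
  using (List; []; _∷_; _++_; length; map; filter; replicate; reverse; upTo; allFin; cartesianProductWith)
open import Data.List.Extrema.Nat using (argmin; f[argmin]≤f[xs])
open import Data.List.Membership.Propositional using (find) renaming (_∈_ to _∈ₗ_)
open import Data.List.Membership.Propositional.Properties
  using (∈-++⁻; ∈-++⁺ˡ; ∈-++⁺ʳ; ∈-∃++; ∈-map⁺; ∈-map⁻; ∈-filter⁺; ∈-filter⁻; ∈-allFin; ∈-upTo⁺;
         ∈-cartesianProductWith⁺; ∈-cartesianProductWith⁻)
open import Data.List.Properties
  using (length-++; length-map; length-replicate; map-++; ∷-injective; unfold-reverse; reverse-involutive; reverse-injective)
open import Data.List.Relation.Binary.Permutation.Propositional using (↭-sym)
open import Data.List.Relation.Binary.Permutation.Propositional.Properties using (All-resp-↭; ↭-reverse)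
open import Data.List.Relation.Unary.All using (All; []; _∷_)
import Data.List.Relation.Unary.All as All
import Data.List.Relation.Unary.All.Properties as All
open import Data.List.Relation.Unary.AllPairs using (AllPairs; []; _∷_)
import Data.List.Relation.Unary.AllPairs as AllPairs
import Data.List.Relation.Unary.AllPairs.Properties as AllPairs
open import Data.List.Relation.Unary.Any using (here; there)
open import Data.List.Relation.Unary.Linked using (Linked; []; [-]; _∷_; linked?)
import Data.List.Relation.Unary.Linked as Linked
open import Data.List.Relation.Unary.Linked.Properties using (Linked⇒All; Linked⇒AllPairs; AllPairs⇒Linked)
open import Data.List.Relation.Unary.Unique.Propositional using (Unique)
import Data.List.Relation.Unary.Unique.Propositional.Properties as Unique
open import Data.Maybe using (Maybe; just; nothing)
import Data.Maybe as Maybe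
open import Data.Maybe.Properties using (just-injective)
import Data.Maybe.Properties as Maybe
open import Data.Nat using (ℕ; zero; suc; _+_; _*_; _≤_; _<_; _≥_; s≤s; z≤n)
open import Data.Nat.ListAction using (sum)
open import Data.Nat.ListAction.Properties using (sum-++; sum-↭)
open import Data.Nat.Solver using (module +-*-Solver)
open import Data.Product using (Σ; ∃; ∃₂; _×_; _,_; proj₁; proj₂)
import Data.Product as Product
open import Data.Sum using (_⊎_; inj₁; inj₂)
import Data.Sum as Sum
open import Data.Vec using ([]; _∷_; here; there; lookup; tabulate)
open import Data.Vec.Properties using (lookup∘tabulate; tabulate-cong; tabulate∘lookup; []=⇒lookup; lookup⇒[]=)
import Data.Vec.Properties as Vec
open import Function using (_∘_; flip; _⇔_; mk⇔; Equivalence)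
import Function.Properties.Equivalence as ⇔
open import Relation.Binary using (DecidableEquality; Transitive; tri<; tri≈; tri>)
open import Relation.Binary.PropositionalEquality
open import Relation.Nullary using (Dec; yes; no; does; ¬?; _×-dec_; map′; recompute)
open import Relation.Nullary.Decidable using (dec-true; dec-false; dec-yes; does-⇔; decidable-stable)

open import Defs

private
  variable
    m : ℕ
    A B : Set
    a b c d x y z : Fin m
    p : Subset m

true⇔true⇒≡ : ∀ {a b : Bool} → (a ≡ true → b ≡ true) → (b ≡ true → a ≡ true) → a ≡ b
true⇔true⇒≡ {true} a⇒b _ = sym (a⇒b refl)
true⇔true⇒≡ {false} {true} _ b⇒a = b⇒a refl
true⇔true⇒≡ {false} {false} _ _ = refl

does⇒ : (a? : Dec A) → does a? ≡ true → A
does⇒ (yes a) _ = a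

does-≡⇒⇔ : (a? : Dec A) (b? : Dec B) → does a? ≡ does b? → A ⇔ B
does-≡⇒⇔ a? b? eq = mk⇔ (λ a → does⇒ b? (trans (sym eq) (dec-true a? a)))
                        (λ b → does⇒ a? (trans eq (dec-true b? b)))

𝟙 : Bool → ℕ
𝟙 true = 1
𝟙 false = 0

just≢nothing : ∀ {a : A} → just a ≢ nothing
just≢nothing ()

first : ∀ {P : Fin m → Set} → (∀ x → Dec (P x)) → Maybe (Fin m)
first {zero} _ = nothing
first {suc m} P? with P? zero
... | yes _ = just zero
... | no _ = Maybe.map suc (first (P? ∘ suc))

first-sound : ∀ {P : Fin m → Set} (P? : ∀ x → Dec (P x)) {r} → first P? ≡ just r → P r
first-sound {suc m} P? eq with P? zero
first-sound {suc m} P? refl | yes P0 = P0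
... | no _ with first (P? ∘ suc) in eq′
first-sound {suc m} P? refl | no _ | just r = first-sound (P? ∘ suc) eq′

first-complete : ∀ {P : Fin m → Set} (P? : ∀ x → Dec (P x)) {y} → P y → ∃ λ r → first P? ≡ just r
first-complete {suc m} P? {y} Py with P? zero
... | yes _ = zero , refl
first-complete {suc m} P? {zero} P0 | no ¬P0 = ⊥-elim (¬P0 P0)
first-complete {suc m} P? {suc y} Py | no _ with first-complete (P? ∘ suc) Py
... | r , eq rewrite eq = suc r , refl

first-cong : ∀ {P Q : Fin m → Set} (P? : ∀ x → Dec (P x)) (Q? : ∀ x → Dec (Q x)) →
             (∀ x → P x ⇔ Q x) → first P? ≡ first Q?
first-cong {zero} _ _ _ = refl
first-cong {suc m} P? Q? P⇔Q with P? zero | Q? zero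
... | yes _ | yes _ = refl
... | no _ | no _ = cong (Maybe.map suc) (first-cong (P? ∘ suc) (Q? ∘ suc) (P⇔Q ∘ suc))
... | yes P0 | no ¬Q0 = ⊥-elim (¬Q0 (Equivalence.to (P⇔Q zero) P0))
... | no ¬P0 | yes Q0 = ⊥-elim (¬P0 (Equivalence.from (P⇔Q zero) Q0))

∈-++-∷⁻ : ∀ (us : List A) {vs b c} → c ∈ₗ us ++ b ∷ vs → c ≢ b → c ∈ₗ us ++ vs
∈-++-∷⁻ us c∈ c≢b with ∈-++⁻ us c∈
... | inj₁ c∈us = ∈-++⁺ˡ c∈us
... | inj₂ (here c≡b) = ⊥-elim (c≢b c≡b)
... | inj₂ (there c∈vs) = ∈-++⁺ʳ us c∈vs

length-++-∷ : ∀ (us : List A) {vs b} → length (us ++ b ∷ vs) ≡ suc (length (us ++ vs))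
length-++-∷ [] = refl
length-++-∷ (u ∷ us) = cong suc (length-++-∷ us)

length-≤ : ∀ (R : A → B → Set) {xs ys} → AllPairs (λ a a′ → ∀ {b} → R a b → R a′ b → ⊥) xs →
           (∀ {a} → a ∈ₗ xs → ∃ λ b → b ∈ₗ ys × R a b) → length xs ≤ length ys
length-≤ R {[]} _ _ = z≤n
length-≤ R {a ∷ xs} (apart ∷ disjoint) image with image (here refl)
... | b , b∈ , Rab with ∈-∃++ b∈
...   | us , vs , refl = subst (suc (length xs) ≤_) (sym (length-++-∷ us)) (s≤s (length-≤ R disjoint image′))
  where
  image′ : ∀ {a′} → a′ ∈ₗ xs → ∃ λ b′ → b′ ∈ₗ us ++ vs × R a′ b′
  image′ a′∈ with image (there a′∈)
  ... | b′ , b′∈ , Ra′b′ = b′ , ∈-++-∷⁻ us b′∈ (λ { refl → All.lookup apart a′∈ Rab Ra′b′ }) , Ra′b′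

length-≡ : ∀ (R : A → B → Set) {xs ys} → AllPairs (λ a a′ → ∀ {b} → R a b → R a′ b → ⊥) xs → Unique ys →
           (∀ {a} → a ∈ₗ xs → ∃ λ b → b ∈ₗ ys × R a b) → (∀ {b} → b ∈ₗ ys → ∃ λ a → a ∈ₗ xs × R a b) →
           (∀ {a b b′} → R a b → R a b′ → b ≡ b′) → length xs ≡ length ys
length-≡ R {xs} disjoint unique image preimage functional = ℕ.≤-antisym (length-≤ R disjoint image)
  (length-≤ (λ b a → a ∈ₗ xs × R a b)
    (AllPairs.map (λ b≢b′ {_} (_ , Rab) (_ , Rab′) → b≢b′ (functional Rab Rab′)) unique)
    (λ b∈ → let a , a∈ , Rab = preimage b∈ in a , a∈ , a∈ , Rab))

unique-length-≡ : ∀ {xs ys : List A} → Unique xs → Unique ys →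
                  (∀ {z} → z ∈ₗ xs → z ∈ₗ ys) → (∀ {z} → z ∈ₗ ys → z ∈ₗ xs) → length xs ≡ length ys
unique-length-≡ uxs uys xs⊆ys ys⊆xs =
  length-≡ _≡_ (AllPairs.map (λ x≢y {_} x≡z y≡z → x≢y (trans x≡z (sym y≡z))) uxs) uys
    (λ z∈ → _ , xs⊆ys z∈ , refl) (λ z∈ → _ , ys⊆xs z∈ , refl) (λ x≡z x≡z′ → trans (sym x≡z) x≡z′)

allPairs-reverse : ∀ {R : A → A → Set} {xs} → AllPairs R xs → AllPairs (flip R) (reverse xs)
allPairs-reverse {xs = []} [] = []
allPairs-reverse {R = R} {x ∷ xs} (Rx ∷ Rxs) = subst (AllPairs (flip R)) (sym (unfold-reverse x xs))
  (AllPairs.++⁺ (allPairs-reverse Rxs) ([] ∷ []) (All.map (_∷ []) (All-resp-↭ (↭-sym (↭-reverse xs)) Rx)))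

linked-reverse : ∀ {R : A → A → Set} {xs} → Transitive R → Linked R xs → Linked (flip R) (reverse xs)
linked-reverse trans = AllPairs⇒Linked ∘ allPairs-reverse ∘ Linked⇒AllPairs trans

linked-∷ : ∀ {a xs} → All (a ≤_) xs → Linked _≤_ xs → Linked _≤_ (a ∷ xs)
linked-∷ [] [] = [-]
linked-∷ (a≤x ∷ _) sorted = a≤x ∷ sorted

linked-≥ : ∀ {lo xs} → Linked _≤_ (lo ∷ xs) → All (lo ≤_) xs
linked-≥ sorted = All.tail (Linked⇒All ℕ.≤-trans ℕ.≤-refl sorted)

-- Two-element subsets, images and isomorphisms

pair : Fin m → Fin m → Subset m
pair x y = ⁅ x ⁆ ∪ ⁅ y ⁆

x∈pair : x ∈ pair x y
x∈pair {x = x} = x∈p∪q⁺ (inj₁ (x∈⁅x⁆ x))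

y∈pair : y ∈ pair x y
y∈pair {y = y} = x∈p∪q⁺ (inj₂ (x∈⁅x⁆ y))

∈pair⁻ : z ∈ pair x y → z ≡ x ⊎ z ≡ y
∈pair⁻ {x = x} {y} z∈ = Sum.map (x∈⁅y⁆⇒x≡y x) (x∈⁅y⁆⇒x≡y y) (x∈p∪q⁻ ⁅ x ⁆ ⁅ y ⁆ z∈)

pair-comm : ∀ (x y : Fin m) → pair x y ≡ pair y x
pair-comm x y = ∪-comm ⁅ x ⁆ ⁅ y ⁆

pair-diag : ∀ (x : Fin m) → pair x x ≡ ⁅ x ⁆
pair-diag x = ∪-idem ⁅ x ⁆

pair-injective : ∀ {x y x′ y′ : Fin m} → x ≢ y → pair x y ≡ pair x′ y′ →
          (x ≡ x′ × y ≡ y′) ⊎ (x ≡ y′ × y ≡ x′)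
pair-injective {x = x} {y} {x′} {y′} x≢y eq
  with ∈pair⁻ {x = x′} {y′} (subst (x ∈_) eq x∈pair)
     | ∈pair⁻ {x = x′} {y′} (subst (y ∈_) eq y∈pair)
... | inj₁ x≡x′ | inj₂ y≡y′ = inj₁ (x≡x′ , y≡y′)
... | inj₂ x≡y′ | inj₁ y≡x′ = inj₂ (x≡y′ , y≡x′)
... | inj₁ x≡x′ | inj₁ y≡x′ = ⊥-elim (x≢y (trans x≡x′ (sym y≡x′)))
... | inj₂ x≡y′ | inj₂ y≡y′ = ⊥-elim (x≢y (trans x≡y′ (sym y≡y′)))

x∈p─q⇒x∉q : ∀ (p q : Subset m) → x ∈ p ─ q → x ∉ q
x∈p─q⇒x∉q (true ∷ p) (false ∷ q) here ()
x∈p─q⇒x∉q (_ ∷ p) (_ ∷ q) (there x∈) (there x∈q) = x∈p─q⇒x∉q p q x∈ x∈q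

pair-exchange : x ≢ y → (pair x y - y) ∪ ⁅ z ⁆ ≡ pair x z
pair-exchange {x = x} {y} {z} x≢y = ⊆-antisym lhs⊆rhs rhs⊆lhs
  where
  lhs⊆rhs : (pair x y - y) ∪ ⁅ z ⁆ ⊆ pair x z
  lhs⊆rhs {w} w∈ with x∈p∪q⁻ (pair x y - y) ⁅ z ⁆ w∈
  ... | inj₂ w∈z rewrite x∈⁅y⁆⇒x≡y z w∈z = y∈pair
  ... | inj₁ w∈p with ∈pair⁻ (p─q⊆p (pair x y) ⁅ y ⁆ w∈p)
  ...   | inj₁ refl = x∈pair
  ...   | inj₂ refl = ⊥-elim (x∈p─q⇒x∉q (pair x y) ⁅ y ⁆ w∈p (x∈⁅x⁆ y))
  rhs⊆lhs : pair x z ⊆ (pair x y - y) ∪ ⁅ z ⁆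
  rhs⊆lhs w∈ with ∈pair⁻ w∈
  ... | inj₁ refl = x∈p∪q⁺ (inj₁ (x∈p∧x≢y⇒x∈p-y x∈pair x≢y))
  ... | inj₂ refl = x∈p∪q⁺ (inj₂ (x∈⁅x⁆ z))

∣pair∣≡2 : x ≢ y → ∣ pair x y ∣ ≡ 2
∣pair∣≡2 {x = zero} {zero} x≢y = ⊥-elim (x≢y refl)
∣pair∣≡2 {x = zero} {suc y} _ = cong suc (trans (cong ∣_∣ (∪-identityˡ ⁅ y ⁆)) (∣⁅x⁆∣≡1 y))
∣pair∣≡2 {x = suc x} {zero} _ =
  cong suc (trans (cong ∣_∣ (∪-comm ⁅ x ⁆ _)) (trans (cong ∣_∣ (∪-identityˡ ⁅ x ⁆)) (∣⁅x⁆∣≡1 x)))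
∣pair∣≡2 {x = suc x} {suc y} x≢y = ∣pair∣≡2 (x≢y ∘ cong suc)

∣p∣≡0⇒p≡∅ : ∀ (p : Subset m) → ∣ p ∣ ≡ 0 → p ≡ ∅
∣p∣≡0⇒p≡∅ [] _ = refl
∣p∣≡0⇒p≡∅ (false ∷ p) ∣p∣≡0 = cong (false ∷_) (∣p∣≡0⇒p≡∅ p ∣p∣≡0)

∣p∣≡1⇒p≡⁅x⁆ : ∀ (p : Subset m) → ∣ p ∣ ≡ 1 → ∃ λ x → p ≡ ⁅ x ⁆
∣p∣≡1⇒p≡⁅x⁆ (true ∷ p) ∣p∣≡1 = zero , cong (true ∷_) (∣p∣≡0⇒p≡∅ p (ℕ.suc-injective ∣p∣≡1))
∣p∣≡1⇒p≡⁅x⁆ (false ∷ p) ∣p∣≡1 with ∣p∣≡1⇒p≡⁅x⁆ p ∣p∣≡1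
... | x , refl = suc x , refl

∣p∣≡2⇒p≡pair : ∀ (p : Subset m) → ∣ p ∣ ≡ 2 → ∃₂ λ x y → x ≢ y × p ≡ pair x y
∣p∣≡2⇒p≡pair (true ∷ p) ∣p∣≡2 with ∣p∣≡1⇒p≡⁅x⁆ p (ℕ.suc-injective ∣p∣≡2)
... | y , refl = zero , suc y , (λ ()) , cong (true ∷_) (sym (∪-identityˡ ⁅ y ⁆))
∣p∣≡2⇒p≡pair (false ∷ p) ∣p∣≡2 with ∣p∣≡2⇒p≡pair p ∣p∣≡2
... | x , y , x≢y , refl = suc x , suc y , x≢y ∘ suc-injective , refl

∈-image⁻ : ∀ (σ : Permutation′ m) → y ∈ image σ p → σ ⟨$⟩ˡ y ∈ p
∈-image⁻ {y = y} {p = p} σ y∈ = lookup⇒[]= _ p (trans (sym (lookup∘tabulate _ y)) ([]=⇒lookup y∈))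

∈-image⁺ : ∀ (σ : Permutation′ m) → σ ⟨$⟩ˡ y ∈ p → y ∈ image σ p
∈-image⁺ {y = y} {p = p} σ σy∈ = lookup⇒[]= y _ (trans (lookup∘tabulate _ y) ([]=⇒lookup σy∈))

image-pair : ∀ (σ : Permutation′ m) x y → image σ (pair x y) ≡ pair (σ ⟨$⟩ʳ x) (σ ⟨$⟩ʳ y)
image-pair σ x y = ⊆-antisym lhs⊆rhs rhs⊆lhs
  where
  lhs⊆rhs : image σ (pair x y) ⊆ pair (σ ⟨$⟩ʳ x) (σ ⟨$⟩ʳ y)
  lhs⊆rhs {z} z∈ with ∈pair⁻ (∈-image⁻ σ z∈)
  ... | inj₁ eq = subst (_∈ _) (trans (cong (σ ⟨$⟩ʳ_) (sym eq)) (inverseʳ σ)) x∈pair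
  ... | inj₂ eq = subst (_∈ _) (trans (cong (σ ⟨$⟩ʳ_) (sym eq)) (inverseʳ σ)) y∈pair
  rhs⊆lhs : pair (σ ⟨$⟩ʳ x) (σ ⟨$⟩ʳ y) ⊆ image σ (pair x y)
  rhs⊆lhs z∈ with ∈pair⁻ z∈
  ... | inj₁ refl = ∈-image⁺ σ (subst (_∈ pair x y) (sym (inverseˡ σ)) x∈pair)
  ... | inj₂ refl = ∈-image⁺ σ (subst (_∈ pair x y) (sym (inverseˡ σ)) y∈pair)

image-flip : ∀ (σ : Permutation′ m) p → image σ (image (Perm.flip σ) p) ≡ p
image-flip σ p = begin
  image σ (image (Perm.flip σ) p)  ≡⟨ tabulate-cong (λ y → trans (lookup∘tabulate _ (σ ⟨$⟩ˡ y))
                                                                (cong (lookup p) (inverseʳ σ))) ⟩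
  tabulate (lookup p)              ≡⟨ tabulate∘lookup p ⟩
  p                                ∎
  where open ≡-Reasoning

image-∘ₚ : ∀ (σ τ : Permutation′ m) p → image τ (image σ p) ≡ image (σ ∘ₚ τ) p
image-∘ₚ σ τ p = tabulate-cong (λ y → lookup∘tabulate _ (τ ⟨$⟩ˡ y))

isomorphic-sym : ∀ {M N : Matroid m} → Isomorphic M N → Isomorphic N M
isomorphic-sym {N = N} (σ , iso) =
  Perm.flip σ , λ X → sym (trans (iso (image (Perm.flip σ) X)) (cong (isBasis N) (image-flip σ X)))

isomorphic-trans : ∀ {M N O : Matroid m} → Isomorphic M N → Isomorphic N O → Isomorphic M O
isomorphic-trans {O = O} (σ , iso₁) (τ , iso₂) =
  σ ∘ₚ τ , λ X → trans (iso₁ X) (trans (iso₂ (image σ X)) (cong (isBasis O) (image-∘ₚ σ τ X)))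

basisPair : Matroid m → Fin m → Fin m → Bool
basisPair M x y = isBasis M (pair x y)

isomorphic⇒basisPair : ∀ {M N : Matroid m} → Isomorphic M N →
  ∃ λ σ → ∀ x y → basisPair M x y ≡ basisPair N (σ ⟨$⟩ʳ x) (σ ⟨$⟩ʳ y)
isomorphic⇒basisPair {N = N} (σ , iso) =
  σ , λ x y → trans (iso (pair x y)) (cong (isBasis N) (image-pair σ x y))

basisPair⇒isomorphic : ∀ {M N : Matroid m} → HasRank 2 M → HasRank 2 N → (σ : Permutation′ m) →
  (∀ x y → basisPair M x y ≡ basisPair N (σ ⟨$⟩ʳ x) (σ ⟨$⟩ʳ y)) → Isomorphic M N
basisPair⇒isomorphic {M = M} {N} rankM rankN σ pairs = σ , λ X → true⇔true⇒≡ (⇒ X) (⇐ X)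
  where
  ⇒ : ∀ X → isBasis M X ≡ true → isBasis N (image σ X) ≡ true
  ⇒ X X∈ with ∣p∣≡2⇒p≡pair X (rankM X X∈)
  ... | x , y , _ , refl = begin
    isBasis N (image σ (pair x y))     ≡⟨ cong (isBasis N) (image-pair σ x y) ⟩
    basisPair N (σ ⟨$⟩ʳ x) (σ ⟨$⟩ʳ y)  ≡⟨ pairs x y ⟨
    basisPair M x y                    ≡⟨ X∈ ⟩
    true                               ∎
    where open ≡-Reasoning
  ⇐ : ∀ X → isBasis N (image σ X) ≡ true → isBasis M X ≡ true
  ⇐ X σX∈ with ∣p∣≡2⇒p≡pair (image σ X) (rankN _ σX∈)
  ... | a , b , _ , σX≡ab = begin
    isBasis M X                                          ≡⟨ cong (isBasis M) X≡ ⟩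
    basisPair M (σ ⟨$⟩ˡ a) (σ ⟨$⟩ˡ b)                    ≡⟨ pairs _ _ ⟩
    basisPair N (σ ⟨$⟩ʳ (σ ⟨$⟩ˡ a)) (σ ⟨$⟩ʳ (σ ⟨$⟩ˡ b))  ≡⟨ cong₂ (basisPair N) (inverseʳ σ) (inverseʳ σ) ⟩
    isBasis N (pair a b)                                 ≡⟨ cong (isBasis N) σX≡ab ⟨
    isBasis N (image σ X)                                ≡⟨ σX∈ ⟩
    true                                                 ∎
    where
    open ≡-Reasoning
    X≡ : X ≡ pair (σ ⟨$⟩ˡ a) (σ ⟨$⟩ˡ b)
    X≡ = begin
      X                                ≡⟨ image-flip (Perm.flip σ) X ⟨
      image (Perm.flip σ) (image σ X)  ≡⟨ cong (image (Perm.flip σ)) σX≡ab ⟩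
      image (Perm.flip σ) (pair a b)   ≡⟨ image-pair (Perm.flip σ) a b ⟩
      pair (σ ⟨$⟩ˡ a) (σ ⟨$⟩ˡ b)       ∎

-- Colourings and their matroids

-- nothing marks a loop, just c a non-loop of colour c
Colouring : ℕ → Set
Colouring m = Fin m → Maybe ℕ

_≟ᶜ_ : DecidableEquality (Maybe ℕ)
_≟ᶜ_ = Maybe.≡-dec ℕ._≟_

record DistinctColours (F : Colouring m) (x y : Fin m) : Set where
  constructor distinct
  field
    nonloopˡ : F x ≢ nothing
    nonloopʳ : F y ≢ nothing
    colours≢ : F x ≢ F y

distinctColours? : ∀ (F : Colouring m) x y → Dec (DistinctColours F x y)
distinctColours? F x y =
  map′ (λ (x≢◌ , y≢◌ , Fx≢Fy) → distinct x≢◌ y≢◌ Fx≢Fy) (λ (distinct x≢◌ y≢◌ Fx≢Fy) → x≢◌ , y≢◌ , Fx≢Fy)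
       (¬? (F x ≟ᶜ nothing) ×-dec ¬? (F y ≟ᶜ nothing) ×-dec ¬? (F x ≟ᶜ F y))

distinctColours-sym : ∀ {F : Colouring m} → DistinctColours F x y → DistinctColours F y x
distinctColours-sym (distinct x≢◌ y≢◌ Fx≢Fy) = distinct y≢◌ x≢◌ (Fx≢Fy ∘ sym)

distinctColours⇒≢ : ∀ {F : Colouring m} → DistinctColours F x y → x ≢ y
distinctColours⇒≢ xy refl = DistinctColours.colours≢ xy refl

partner : ∀ {F : Colouring m} {a c d} → DistinctColours F c d → F a ≢ nothing →
          ∃ λ y → y ∈ pair c d × DistinctColours F a y
partner {F = F} {a} {c} {d} (distinct c≢◌ d≢◌ Fc≢Fd) a≢◌ with F a ≟ᶜ F c
... | yes Fa≡Fc = d , y∈pair , distinct a≢◌ d≢◌ λ Fa≡Fd → Fc≢Fd (trans (sym Fa≡Fc) Fa≡Fd)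
... | no Fa≢Fc = c , x∈pair , distinct a≢◌ c≢◌ Fa≢Fc

TwoColoured : Colouring m → Set
TwoColoured F = ∃₂ (DistinctColours F)

twoColoured? : ∀ (F : Colouring m) → Dec (TwoColoured F)
twoColoured? F = any? λ x → any? λ y → distinctColours? F x y

distinctColours-∘ : ∀ {n} {G : Colouring m} (f : Fin n → Fin m) {x y} →
                    DistinctColours (G ∘ f) x y ⇔ DistinctColours G (f x) (f y)
distinctColours-∘ f = mk⇔ (λ (distinct x≢◌ y≢◌ c≢) → distinct x≢◌ y≢◌ c≢)
                          (λ (distinct x≢◌ y≢◌ c≢) → distinct x≢◌ y≢◌ c≢)

twoColoured-permute : ∀ {G : Colouring m} (σ : Permutation′ m) → TwoColoured G → TwoColoured (G ∘ (σ ⟨$⟩ʳ_))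
twoColoured-permute {G = G} σ (x , y , xy) = σ ⟨$⟩ˡ x , σ ⟨$⟩ˡ y , Equivalence.from (distinctColours-∘ (σ ⟨$⟩ʳ_))
  (subst₂ (DistinctColours G) (sym (inverseʳ σ)) (sym (inverseʳ σ)) xy)

IsColourBasis : Colouring m → Subset m → Set
IsColourBasis F X = ∃₂ λ x y → DistinctColours F x y × X ≡ pair x y

isColourBasis? : ∀ (F : Colouring m) X → Dec (IsColourBasis F X)
isColourBasis? F X = any? λ x → any? λ y → distinctColours? F x y ×-dec Vec.≡-dec Bool._≟_ X (pair x y)

module _ (F : Colouring m) where

  private
    exchange-second : DistinctColours F a b → DistinctColours F c d → b ∉ pair c d →
      ∃ λ y → y ∈ pair c d × y ∉ pair a b × IsColourBasis F ((pair a b - b) ∪ ⁅ y ⁆)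
    exchange-second {a = a} {b} {c} {d} ab@(distinct a≢◌ _ _) cd b∉cd with partner cd a≢◌
    ... | y , y∈ , ay = y , y∈ , y∉ , a , y , ay , pair-exchange (distinctColours⇒≢ ab)
      where
      y∉ : y ∉ pair a b
      y∉ y∈ab with ∈pair⁻ y∈ab
      ... | inj₁ refl = distinctColours⇒≢ {F = F} ay refl
      ... | inj₂ refl = b∉cd y∈

  colourExchange : ∀ B₁ B₂ → IsColourBasis F B₁ → IsColourBasis F B₂ → ∀ x → x ∈ B₁ → x ∉ B₂ →
    ∃ λ y → y ∈ B₂ × y ∉ B₁ × IsColourBasis F ((B₁ - x) ∪ ⁅ y ⁆)
  colourExchange _ _ (a , b , ab , refl) (c , d , cd , refl) x x∈ x∉ with ∈pair⁻ x∈
  ... | inj₂ refl = exchange-second ab cd x∉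
  ... | inj₁ refl rewrite pair-comm a b = exchange-second (distinctColours-sym ab) cd x∉

  -- The witness is irrelevant, so colour matroids of one colouring are definitionally equal.
  colourMatroid : .(TwoColoured F) → Matroid m
  colourMatroid two = record
    { isBasis  = does ∘ isColourBasis? F
    ; nonempty = let x , y , xy = recompute (twoColoured? F) two
                 in  pair x y , dec-true (isColourBasis? F _) (x , y , xy , refl)
    ; exchange = λ B₁ B₂ B₁∈ B₂∈ x x∈ x∉ →
        let y , y∈ , y∉ , B∈ = colourExchange B₁ B₂ (does⇒ (isColourBasis? F B₁) B₁∈)
                                               (does⇒ (isColourBasis? F B₂) B₂∈) x x∈ x∉
        in  y , y∈ , y∉ , dec-true (isColourBasis? F _) B∈
    }

  colourMatroid-rank : ∀ .two → HasRank 2 (colourMatroid two)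
  colourMatroid-rank _ X X∈ with does⇒ (isColourBasis? F X) X∈
  ... | x , y , xy , refl = ∣pair∣≡2 (distinctColours⇒≢ xy)

  colourMatroid-basisPair : ∀ .two x y → basisPair (colourMatroid two) x y ≡ does (distinctColours? F x y)
  colourMatroid-basisPair _ x y = does-⇔ (mk⇔ to from) (isColourBasis? F (pair x y)) (distinctColours? F x y)
    where
    to : IsColourBasis F (pair x y) → DistinctColours F x y
    to (a , b , ab , eq) with pair-injective (distinctColours⇒≢ ab) (sym eq)
    ... | inj₁ (refl , refl) = ab
    ... | inj₂ (refl , refl) = distinctColours-sym ab
    from : DistinctColours F x y → IsColourBasis F (pair x y)
    from xy = x , y , xy , refl

record _∼_ (F G : Colouring m) : Set where
  field
    sameColour : ∀ x y → F x ≡ F y ⇔ G x ≡ G y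
    sameLoops  : ∀ x → F x ≡ nothing ⇔ G x ≡ nothing

open _∼_

∼-sym : ∀ {F G : Colouring m} → F ∼ G → G ∼ F
∼-sym F∼G = record
  { sameColour = λ x y → ⇔.sym (sameColour F∼G x y)
  ; sameLoops  = λ x → ⇔.sym (sameLoops F∼G x)
  }

∼-resp-≗ : ∀ {F G H : Colouring m} → F ∼ G → (∀ x → G x ≡ H x) → F ∼ H
∼-resp-≗ {G = G} {H} F∼G G≗H = record
  { sameColour = λ x y → ⇔.trans (sameColour F∼G x y)
      (mk⇔ (λ eq → trans (sym (G≗H x)) (trans eq (G≗H y))) (λ eq → trans (G≗H x) (trans eq (sym (G≗H y)))))
  ; sameLoops  = λ x → ⇔.trans (sameLoops F∼G x) (mk⇔ (trans (sym (G≗H x))) (trans (G≗H x)))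
  }

∼-distinctColours : ∀ {F G : Colouring m} {x y} → F ∼ G → DistinctColours F x y → DistinctColours G x y
∼-distinctColours {x = x} {y} F∼G (distinct x≢◌ y≢◌ colours≢) = distinct
  (x≢◌ ∘ Equivalence.from (sameLoops F∼G x))
  (y≢◌ ∘ Equivalence.from (sameLoops F∼G y))
  (colours≢ ∘ Equivalence.from (sameColour F∼G x y))

private
  loops⇒ : ∀ {F G : Colouring m} → TwoColoured G → (∀ x y → DistinctColours G x y → DistinctColours F x y) →
           ∀ x → F x ≡ nothing → G x ≡ nothing
  loops⇒ {G = G} (_ , _ , cd) G⇒F x Fx≡◌ = decidable-stable (G x ≟ᶜ nothing) λ Gx≢◌ →
    let y , _ , xy = partner cd Gx≢◌ in DistinctColours.nonloopˡ (G⇒F x y xy) Fx≡◌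

  colours⇒ : ∀ {F G : Colouring m} → (∀ x → F x ≡ nothing ⇔ G x ≡ nothing) →
             (∀ x y → DistinctColours G x y → DistinctColours F x y) →
             ∀ x y → F x ≡ F y → G x ≡ G y
  colours⇒ {F = F} {G} loops G⇒F x y Fx≡Fy with F x ≟ᶜ nothing
  ... | yes Fx≡◌ =
    trans (Equivalence.to (loops x) Fx≡◌) (sym (Equivalence.to (loops y) (trans (sym Fx≡Fy) Fx≡◌)))
  ... | no Fx≢◌ = decidable-stable (G x ≟ᶜ G y) λ Gx≢Gy →
    DistinctColours.colours≢ (G⇒F x y (distinct (Fx≢◌ ∘ Equivalence.from (loops x))
                                                  (Fx≢◌ ∘ trans Fx≡Fy ∘ Equivalence.from (loops y)) Gx≢Gy)) Fx≡Fy

distinctColours⇒∼ : ∀ {F G : Colouring m} → TwoColoured F → TwoColoured G →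
                    (∀ x y → DistinctColours F x y ⇔ DistinctColours G x y) → F ∼ G
distinctColours⇒∼ {F = F} {G} twoF twoG F⇔G = record
  { sameColour = λ x y → mk⇔ (colours⇒ loops G⇒F x y) (colours⇒ (⇔.sym ∘ loops) F⇒G x y)
  ; sameLoops  = loops
  }
  where
  F⇒G : ∀ x y → DistinctColours F x y → DistinctColours G x y
  F⇒G x y = Equivalence.to (F⇔G x y)
  G⇒F : ∀ x y → DistinctColours G x y → DistinctColours F x y
  G⇒F x y = Equivalence.from (F⇔G x y)
  loops : ∀ x → F x ≡ nothing ⇔ G x ≡ nothing
  loops x = mk⇔ (loops⇒ twoG G⇒F x) (loops⇒ twoF F⇒G x)

∼⇒does-distinctColours : ∀ {F G : Colouring m} (σ : Permutation′ m) → F ∼ (G ∘ (σ ⟨$⟩ʳ_)) →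
  ∀ x y → does (distinctColours? F x y) ≡ does (distinctColours? G (σ ⟨$⟩ʳ x) (σ ⟨$⟩ʳ y))
∼⇒does-distinctColours {F = F} {G} σ F∼Gσ x y = does-⇔
  (mk⇔ (Equivalence.to (distinctColours-∘ (σ ⟨$⟩ʳ_)) ∘ ∼-distinctColours F∼Gσ)
       (∼-distinctColours (∼-sym F∼Gσ) ∘ Equivalence.from (distinctColours-∘ (σ ⟨$⟩ʳ_))))
  (distinctColours? F x y) (distinctColours? G _ _)

colourMatroid-isomorphic⇒∼ : ∀ {F G : Colouring m} twoF twoG →
  Isomorphic (colourMatroid F twoF) (colourMatroid G twoG) → ∃ λ σ → F ∼ (G ∘ (σ ⟨$⟩ʳ_))
colourMatroid-isomorphic⇒∼ {F = F} {G} twoF twoG iso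
  with isomorphic⇒basisPair {M = colourMatroid F twoF} {N = colourMatroid G twoG} iso
... | σ , pairs = σ , distinctColours⇒∼ twoF (twoColoured-permute σ twoG) λ x y →
  ⇔.trans (does-≡⇒⇔ (distinctColours? F x y) (distinctColours? G (σ ⟨$⟩ʳ x) (σ ⟨$⟩ʳ y))
             (trans (sym (colourMatroid-basisPair F twoF x y))
                    (trans (pairs x y) (colourMatroid-basisPair G twoG (σ ⟨$⟩ʳ x) (σ ⟨$⟩ʳ y)))))
          (⇔.sym (distinctColours-∘ (σ ⟨$⟩ʳ_)))

-- Rank-2 matroids are colour matroids

module RankTwo {m} (M : Matroid m) (rank₂ : HasRank 2 M) where

  basisPair-comm : ∀ x y → basisPair M x y ≡ basisPair M y x
  basisPair-comm x y = cong (isBasis M) (pair-comm x y)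

  basisPair-≢ : ∀ {x y} → basisPair M x y ≡ true → x ≢ y
  basisPair-≢ {x} xx refl with trans (sym (rank₂ _ xx)) (trans (cong ∣_∣ (pair-diag x)) (∣⁅x⁆∣≡1 x))
  ... | ()

  basisPair-diag : ∀ x → basisPair M x x ≡ false
  basisPair-diag x = Bool.¬-not λ xx → basisPair-≢ xx refl

  basisPair-exchange : ∀ {x z w v} → basisPair M x z ≡ true → basisPair M w v ≡ true →
                       basisPair M w x ≡ true ⊎ basisPair M w z ≡ true
  basisPair-exchange {x} {z} {w} {v} xz wv with v ∈? pair x z
  ... | yes v∈ with ∈pair⁻ v∈
  ...   | inj₁ refl = inj₁ wv
  ...   | inj₂ refl = inj₂ wv
  basisPair-exchange {x} {z} {w} {v} xz wv | no v∉
    with exchange M (pair w v) (pair x z) wv xz v y∈pair v∉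
  ... | y , y∈ , _ , B∈ with ∈pair⁻ y∈ | trans (cong (isBasis M) (sym (pair-exchange (basisPair-≢ wv)))) B∈
  ...   | inj₁ refl | wy = inj₁ wy
  ...   | inj₂ refl | wy = inj₂ wy

  NonLoop : Fin m → Set
  NonLoop x = ∃ λ y → basisPair M x y ≡ true

  nonLoop? : ∀ x → Dec (NonLoop x)
  nonLoop? x = any? λ y → basisPair M x y Bool.≟ true

  Parallel : Fin m → Fin m → Set
  Parallel x z = NonLoop z × basisPair M x z ≡ false

  parallel? : ∀ x z → Dec (Parallel x z)
  parallel? x z = nonLoop? z ×-dec (basisPair M x z Bool.≟ false)

  colour : Colouring m
  colour x with nonLoop? x
  ... | yes _ = Maybe.map toℕ (first (parallel? x))
  ... | no _ = nothing

  colour-nonLoop : ∀ {x} → NonLoop x → colour x ≡ Maybe.map toℕ (first (parallel? x))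
  colour-nonLoop {x} x° with nonLoop? x
  ... | yes _ = refl
  ... | no ¬x° = ⊥-elim (¬x° x°)

  colour≢nothing⇒nonLoop : ∀ {x} → colour x ≢ nothing → NonLoop x
  colour≢nothing⇒nonLoop {x} x≢◌ with nonLoop? x
  ... | yes x° = x°
  ... | no _ = ⊥-elim (x≢◌ refl)

  nonLoop-colour : ∀ {x} → NonLoop x → ∃ λ r → Parallel x r × colour x ≡ just (toℕ r)
  nonLoop-colour {x} x° with first-complete (parallel? x) (x° , basisPair-diag x)
  ... | r , eq = r , first-sound (parallel? x) eq , trans (colour-nonLoop x°) (cong (Maybe.map toℕ) eq)

  parallel⇒sameNeighbours : ∀ {x y} → NonLoop x → NonLoop y → basisPair M x y ≡ false →
                           ∀ z → basisPair M x z ≡ basisPair M y z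
  parallel⇒sameNeighbours {x} {y} (v , xv) (w , yw) xy≡false z = true⇔true⇒≡ (to yw) (from xv)
    where
    to : ∀ {w} → basisPair M y w ≡ true → basisPair M x z ≡ true → basisPair M y z ≡ true
    to yw xz with basisPair-exchange xz yw
    ... | inj₁ yx = ⊥-elim (Bool.not-¬ yx (trans (basisPair-comm y x) xy≡false))
    ... | inj₂ yz = yz
    from : ∀ {v} → basisPair M x v ≡ true → basisPair M y z ≡ true → basisPair M x z ≡ true
    from xv yz with basisPair-exchange yz xv
    ... | inj₁ xy = ⊥-elim (Bool.not-¬ xy xy≡false)
    ... | inj₂ xz = xz

  nonLoop⇒colour≢nothing : ∀ {x} → NonLoop x → colour x ≢ nothing
  nonLoop⇒colour≢nothing x° eq with nonLoop-colour x°
  ... | _ , _ , cx with trans (sym eq) cx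
  ...   | ()

  basisPair⇒distinctColours : ∀ {x y} → basisPair M x y ≡ true → DistinctColours colour x y
  basisPair⇒distinctColours {x} {y} xy = distinct (nonLoop⇒colour≢nothing x°) (nonLoop⇒colour≢nothing y°) colours≢
    where
    x° : NonLoop x
    x° = y , xy
    y° : NonLoop y
    y° = x , trans (basisPair-comm y x) xy
    falsified : ∀ {u v} → basisPair M u v ≡ true → basisPair M v u ≡ false → ⊥
    falsified uv vu = Bool.not-¬ uv (trans (basisPair-comm _ _) vu)
    colours≢ : colour x ≢ colour y
    colours≢ eq with nonLoop-colour x° | nonLoop-colour y°
    ... | r , ((v , rv) , xr) , cx | s , (_ , yr) , cy
      with toℕ-injective (just-injective (trans (sym cx) (trans eq cy)))
    ...   | refl with basisPair-exchange xy rv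
    ...     | inj₁ rx = falsified rx xr
    ...     | inj₂ ry = falsified ry yr

  distinctColours⇒basisPair : ∀ {x y} → DistinctColours colour x y → basisPair M x y ≡ true
  distinctColours⇒basisPair {x} {y} (distinct x≢◌ y≢◌ colours≢) with basisPair M x y in xy
  ... | true = refl
  ... | false = ⊥-elim (colours≢ (begin
    colour x                             ≡⟨ colour-nonLoop x° ⟩
    Maybe.map toℕ (first (parallel? x))  ≡⟨ cong (Maybe.map toℕ) (first-cong (parallel? x) (parallel? y) same) ⟩
    Maybe.map toℕ (first (parallel? y))  ≡⟨ colour-nonLoop y° ⟨
    colour y                             ∎))
    where
    open ≡-Reasoning
    x° : NonLoop x
    x° = colour≢nothing⇒nonLoop x≢◌
    y° : NonLoop y
    y° = colour≢nothing⇒nonLoop y≢◌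
    same : ∀ z → Parallel x z ⇔ Parallel y z
    same z = mk⇔ (λ (z° , xz) → z° , trans (sym (parallel⇒sameNeighbours x° y° xy z)) xz)
                 (λ (z° , yz) → z° , trans (parallel⇒sameNeighbours x° y° xy z) yz)

  basisPair≡distinctColours : ∀ x y → basisPair M x y ≡ does (distinctColours? colour x y)
  basisPair≡distinctColours x y =
    true⇔true⇒≡ (dec-true (distinctColours? colour x y) ∘ basisPair⇒distinctColours)
                (distinctColours⇒basisPair ∘ does⇒ (distinctColours? colour x y))

  colour-twoColoured : TwoColoured colour
  colour-twoColoured with nonempty M
  ... | B , B∈ with ∣p∣≡2⇒p≡pair B (rank₂ B B∈)
  ...   | x , y , _ , refl = x , y , basisPair⇒distinctColours B∈

-- Counting colours and extending colour renamings

count : Colouring m → Maybe ℕ → ℕ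
count F c = ∑ λ x → 𝟙 (does (F x ≟ᶜ c))

count-cong : ∀ {F G : Colouring m} {c d} → (∀ x → F x ≡ c ⇔ G x ≡ d) → count F c ≡ count G d
count-cong {F = F} {G} {c} {d} F⇔G = sum-cong-≗ λ x → cong 𝟙 (does-⇔ (F⇔G x) (F x ≟ᶜ c) (G x ≟ᶜ d))

count-permute : ∀ (F : Colouring m) (σ : Permutation′ m) c → count (F ∘ (σ ⟨$⟩ʳ_)) c ≡ count F c
count-permute F σ c = sym (sum-permute (λ x → 𝟙 (does (F x ≟ᶜ c))) σ)

count-punchIn : ∀ (F : Colouring (suc m)) x c →
                count F c ≡ 𝟙 (does (F x ≟ᶜ c)) + count (F ∘ punchIn x) c
count-punchIn F x c = sum-remove {i = x} (λ y → 𝟙 (does (F y ≟ᶜ c)))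

∼-count : ∀ {F G : Colouring m} → F ∼ G → ∀ x → count F (F x) ≡ count G (G x)
∼-count F∼G x = count-cong λ y → sameColour F∼G y x

∼-countLoops : ∀ {F G : Colouring m} → F ∼ G → count F nothing ≡ count G nothing
∼-countLoops F∼G = count-cong (sameLoops F∼G)

punchIn-view : ∀ (x u : Fin (suc m)) → u ≡ x ⊎ ∃ λ k → u ≡ punchIn x k
punchIn-view x u with u ≟ x
... | yes u≡x = inj₁ u≡x
... | no u≢x = inj₂ (punchOut (u≢x ∘ sym) , sym (punchIn-punchOut (u≢x ∘ sym)))

∼-punchIn : ∀ (x : Fin (suc m)) {F G : Colouring (suc m)} → (F ∘ punchIn x) ∼ (G ∘ punchIn x) →
            (∀ k → F x ≡ F (punchIn x k) ⇔ G x ≡ G (punchIn x k)) →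
            (F x ≡ nothing ⇔ G x ≡ nothing) → F ∼ G
∼-punchIn x {F} {G} rest new newLoop = record { sameColour = colours ; sameLoops = loops }
  where
  ≡-comm : ∀ {A : Set} {a b : A} → a ≡ b ⇔ b ≡ a
  ≡-comm = mk⇔ sym sym
  colours : ∀ u v → F u ≡ F v ⇔ G u ≡ G v
  colours u v with punchIn-view x u | punchIn-view x v
  ... | inj₁ refl | inj₁ refl = mk⇔ (λ _ → refl) (λ _ → refl)
  ... | inj₁ refl | inj₂ (k , refl) = new k
  ... | inj₂ (k , refl) | inj₁ refl = ⇔.trans ≡-comm (⇔.trans (new k) ≡-comm)
  ... | inj₂ (k , refl) | inj₂ (l , refl) = sameColour rest k l
  loops : ∀ u → F u ≡ nothing ⇔ G u ≡ nothing
  loops u with punchIn-view x u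
  ... | inj₁ refl = newLoop
  ... | inj₂ (k , refl) = sameLoops rest k

insert-self : ∀ (i j : Fin (suc m)) (π : Permutation′ m) → insert i j π ⟨$⟩ʳ i ≡ j
insert-self i j π rewrite proj₂ (dec-yes (i ≟ i) refl) = refl

∼-insert : ∀ {F G : Colouring (suc m)} {G₀ : Colouring m} (x p : Fin (suc m)) (σ : Permutation′ m) →
           (F ∘ punchIn x) ∼ (G₀ ∘ (σ ⟨$⟩ʳ_)) → (∀ k → G (punchIn p k) ≡ G₀ k) →
           (∀ k → F x ≡ F (punchIn x k) ⇔ G p ≡ G₀ (σ ⟨$⟩ʳ k)) → (F x ≡ nothing ⇔ G p ≡ nothing) →
           F ∼ (G ∘ (insert x p σ ⟨$⟩ʳ_))
∼-insert {G = G} {G₀} x p σ rest G≗G₀ new newLoop = ∼-punchIn x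
  (∼-resp-≗ rest λ k → sym (trans (cong G (insert-punchIn x p σ k)) (G≗G₀ (σ ⟨$⟩ʳ k))))
  (λ k → ⇔.trans (new k) (≡-resp (sym Gx) (sym (Gk k))))
  (⇔.trans newLoop (≡-resp (sym Gx) refl))
  where
  ≡-resp : ∀ {a a′ b b′ : Maybe ℕ} → a ≡ a′ → b ≡ b′ → a ≡ b ⇔ a′ ≡ b′
  ≡-resp refl refl = ⇔.refl
  Gx : G (insert x p σ ⟨$⟩ʳ x) ≡ G p
  Gx = cong G (insert-self x p σ)
  Gk : ∀ k → G (insert x p σ ⟨$⟩ʳ punchIn x k) ≡ G₀ (σ ⟨$⟩ʳ k)
  Gk k = trans (cong G (insert-punchIn x p σ k)) (G≗G₀ (σ ⟨$⟩ʳ k))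

-- Canonical colourings

listColouring : List (Maybe ℕ) → Colouring m
listColouring [] _ = nothing
listColouring (a ∷ L) zero = a
listColouring (a ∷ L) (suc x) = listColouring L x

countᴸ : Maybe ℕ → List (Maybe ℕ) → ℕ
countᴸ c [] = 0
countᴸ c (a ∷ L) = 𝟙 (does (a ≟ᶜ c)) + countᴸ c L

count-listColouring : ∀ L → length L ≡ m → ∀ c → count (listColouring {m} L) c ≡ countᴸ c L
count-listColouring [] refl c = refl
count-listColouring (a ∷ L) refl c = cong (𝟙 (does (a ≟ᶜ c)) +_) (count-listColouring L refl c)

listColouring-∈ : ∀ L {x : Fin m} {v} → listColouring L x ≡ just v → just v ∈ₗ L
listColouring-∈ (a ∷ L) {zero} refl = here refl
listColouring-∈ (a ∷ L) {suc x} eq = there (listColouring-∈ L eq)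

∈⇒listColouring : ∀ L {v} → v ∈ₗ L → length L ≡ m → ∃ λ (x : Fin m) → listColouring L x ≡ v
∈⇒listColouring (a ∷ L) (here refl) refl = zero , refl
∈⇒listColouring (a ∷ L) (there v∈) refl with ∈⇒listColouring L v∈ refl
... | x , eq = suc x , eq

countᴸ-++ : ∀ c A B → countᴸ c (A ++ B) ≡ countᴸ c A + countᴸ c B
countᴸ-++ c [] B = refl
countᴸ-++ c (a ∷ A) B =
  trans (cong (𝟙 (does (a ≟ᶜ c)) +_) (countᴸ-++ c A B)) (sym (ℕ.+-assoc (𝟙 (does (a ≟ᶜ c))) (countᴸ c A) (countᴸ c B)))

countᴸ-replicate : ∀ n c → countᴸ c (replicate n c) ≡ n
countᴸ-replicate zero c = refl
countᴸ-replicate (suc n) c rewrite dec-true (c ≟ᶜ c) refl = cong suc (countᴸ-replicate n c)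

countᴸ-replicate-≢ : ∀ n {a c} → a ≢ c → countᴸ c (replicate n a) ≡ 0
countᴸ-replicate-≢ zero _ = refl
countᴸ-replicate-≢ (suc n) {a} {c} a≢c rewrite dec-false (a ≟ᶜ c) a≢c = countᴸ-replicate-≢ n a≢c

∈-replicate⁻ : ∀ n {a b : Maybe ℕ} → b ∈ₗ replicate n a → b ≡ a
∈-replicate⁻ n {a} = All.lookup (All.replicate⁺ {P = _≡ a} n refl)

-- A block is coloured by the number of blocks after it, so prepending a block keeps all colours.
blocks : List ℕ → List (Maybe ℕ)
blocks [] = []
blocks (t ∷ ts) = replicate t (just (length ts)) ++ blocks ts

layout : ℕ → List ℕ → List (Maybe ℕ)
layout l ts = replicate l nothing ++ blocks ts

canonical : ℕ → List ℕ → Colouring m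
canonical l ts = listColouring (layout l ts)

length-blocks : ∀ ts → length (blocks ts) ≡ sum ts
length-blocks [] = refl
length-blocks (t ∷ ts) = trans (length-++ (replicate t _)) (cong₂ _+_ (length-replicate t) (length-blocks ts))

length-layout : ∀ l ts → length (layout l ts) ≡ l + sum ts
length-layout l ts = trans (length-++ (replicate l _)) (cong₂ _+_ (length-replicate l) (length-blocks ts))

blocks-colour< : ∀ ts {c} → just c ∈ₗ blocks ts → c < length ts
blocks-colour< (t ∷ ts) c∈ with ∈-++⁻ (replicate t _) c∈
... | inj₁ c∈t rewrite just-injective (∈-replicate⁻ t c∈t) = ℕ.n<1+n (length ts)
... | inj₂ c∈ts = ℕ.m<n⇒m<1+n (blocks-colour< ts c∈ts)

∈-layout⁻ : ∀ l ts {c} → just c ∈ₗ layout l ts → just c ∈ₗ blocks ts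
∈-layout⁻ l ts c∈ with ∈-++⁻ (replicate l _) c∈
... | inj₁ c∈l with () ← ∈-replicate⁻ l c∈l
... | inj₂ c∈ts = c∈ts

countᴸ-blocks-≥ : ∀ ts {c} → length ts ≤ c → countᴸ (just c) (blocks ts) ≡ 0
countᴸ-blocks-≥ [] _ = refl
countᴸ-blocks-≥ (t ∷ ts) {c} ts≤c = trans (countᴸ-++ (just c) (replicate t _) (blocks ts))
  (cong₂ _+_ (countᴸ-replicate-≢ t (ℕ.<⇒≢ ts≤c ∘ just-injective)) (countᴸ-blocks-≥ ts (ℕ.<⇒≤ ts≤c)))

countᴸ-blocks-head : ∀ t ts → countᴸ (just (length ts)) (blocks (t ∷ ts)) ≡ t
countᴸ-blocks-head t ts = trans (countᴸ-++ _ (replicate t _) (blocks ts))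
  (trans (cong₂ _+_ (countᴸ-replicate t _) (countᴸ-blocks-≥ ts ℕ.≤-refl)) (ℕ.+-identityʳ t))

countᴸ-blocks-tail : ∀ t ts {c} → c < length ts →
                     countᴸ (just c) (blocks (t ∷ ts)) ≡ countᴸ (just c) (blocks ts)
countᴸ-blocks-tail t ts {c} c<ts = trans (countᴸ-++ _ (replicate t _) (blocks ts))
  (cong (_+ countᴸ (just c) (blocks ts)) (countᴸ-replicate-≢ t (ℕ.<⇒≢ c<ts ∘ sym ∘ just-injective)))

countᴸ-blocks-∈ : ∀ ts {c} → just c ∈ₗ blocks ts → countᴸ (just c) (blocks ts) ∈ₗ ts
countᴸ-blocks-∈ (t ∷ ts) {c} c∈ with ∈-++⁻ (replicate t _) c∈
... | inj₁ c∈t rewrite just-injective (∈-replicate⁻ t c∈t) = here (countᴸ-blocks-head t ts)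
... | inj₂ c∈ts rewrite countᴸ-blocks-tail t ts (blocks-colour< ts c∈ts) = there (countᴸ-blocks-∈ ts c∈ts)

countᴸ-layout : ∀ l ts c → countᴸ (just c) (layout l ts) ≡ countᴸ (just c) (blocks ts)
countᴸ-layout l ts c = trans (countᴸ-++ _ (replicate l nothing) (blocks ts))
  (cong (_+ countᴸ (just c) (blocks ts)) (countᴸ-replicate-≢ l λ ()))

countᴸ-layout-loops : ∀ l ts → countᴸ nothing (layout l ts) ≡ l
countᴸ-layout-loops l ts = trans (countᴸ-++ _ (replicate l nothing) (blocks ts))
  (trans (cong₂ _+_ (countᴸ-replicate l nothing) (noLoops ts)) (ℕ.+-identityʳ l))
  where
  noLoops : ∀ ts → countᴸ nothing (blocks ts) ≡ 0
  noLoops [] = refl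
  noLoops (t ∷ ts) =
    trans (countᴸ-++ _ (replicate t _) (blocks ts)) (cong₂ _+_ (countᴸ-replicate-≢ t λ ()) (noLoops ts))

listColouring-at : ∀ l (w : Maybe ℕ) B (l<m : l < suc m) →
                   listColouring (replicate l nothing ++ w ∷ B) (fromℕ< l<m) ≡ w
listColouring-at zero w B _ = refl
listColouring-at {suc m} (suc l) w B (s≤s l<m) = listColouring-at l w B l<m

listColouring-punchIn : ∀ l (w : Maybe ℕ) B (l<m : l < suc m) (k : Fin m) →
  listColouring (replicate l nothing ++ w ∷ B) (punchIn (fromℕ< l<m) k) ≡
  listColouring (replicate l nothing ++ B) k
listColouring-punchIn zero w B _ k = refl
listColouring-punchIn {suc m} (suc l) w B (s≤s l<m) zero = refl
listColouring-punchIn {suc m} (suc l) w B (s≤s l<m) (suc k) = listColouring-punchIn l w B l<m k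

canonical-∈⁻ : ∀ l ts {x : Fin m} {c} → canonical l ts x ≡ just c → just c ∈ₗ blocks ts
canonical-∈⁻ l ts Gx = ∈-layout⁻ l ts (listColouring-∈ (layout l ts) Gx)

canonical-∈⁺ : ∀ l ts → l + sum ts ≡ m → ∀ {c} → just c ∈ₗ blocks ts → ∃ λ x → canonical {m} l ts x ≡ just c
canonical-∈⁺ l ts total c∈ =
  ∈⇒listColouring (layout l ts) (∈-++⁺ʳ (replicate l nothing) c∈) (trans (length-layout l ts) total)

count-canonical : ∀ l ts → l + sum ts ≡ m → ∀ c → count (canonical {m} l ts) (just c) ≡ countᴸ (just c) (blocks ts)
count-canonical l ts total c =
  trans (count-listColouring (layout l ts) (trans (length-layout l ts) total) (just c)) (countᴸ-layout l ts c)

count-canonical-loops : ∀ l ts → l + sum ts ≡ m → count (canonical {m} l ts) nothing ≡ l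
count-canonical-loops l ts total =
  trans (count-listColouring (layout l ts) (trans (length-layout l ts) total) nothing) (countᴸ-layout-loops l ts)

-- Existence of canonical forms

-- Linked _≤_ (1 ∷ xs) says that xs is non-decreasing with positive entries.
record CanonicalForm (F : Colouring m) : Set where
  field
    loops    : ℕ
    sizes    : List ℕ
    sorted   : Linked _≤_ (1 ∷ sizes)
    size-sum : loops + sum sizes ≡ m
    perm     : Permutation′ m
    similar  : F ∼ (canonical loops sizes ∘ (perm ⟨$⟩ʳ_))

extendByLoop : ∀ {F : Colouring (suc m)} x → F x ≡ nothing → CanonicalForm (F ∘ punchIn x) → CanonicalForm F
extendByLoop {F = F} x Fx≡◌ form = record
  { loops    = suc loops
  ; sizes    = sizes
  ; sorted   = sorted
  ; size-sum = cong suc size-sum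
  ; perm     = insert x zero perm
  ; similar  = ∼-insert {G = canonical (suc loops) sizes} x zero perm similar (λ _ → refl) new
                        (mk⇔ (λ _ → refl) (λ _ → Fx≡◌))
  }
  where
  open CanonicalForm form
  new : ∀ k → F x ≡ F (punchIn x k) ⇔ nothing ≡ canonical loops sizes (perm ⟨$⟩ʳ k)
  new k = mk⇔ (λ eq → sym (Equivalence.to (_∼_.sameLoops similar k) (trans (sym eq) Fx≡◌)))
              (λ eq → trans Fx≡◌ (sym (Equivalence.from (_∼_.sameLoops similar k) (sym eq))))

extendFirstBlock : ∀ {F : Colouring (suc m)} x l t ts (σ : Permutation′ m) →
  (F ∘ punchIn x) ∼ (canonical l (t ∷ ts) ∘ (σ ⟨$⟩ʳ_)) →
  (∀ k → F x ≡ F (punchIn x k) ⇔ just (length ts) ≡ canonical l (t ∷ ts) (σ ⟨$⟩ʳ k)) →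
  F x ≢ nothing → Linked _≤_ (1 ∷ suc t ∷ ts) → l + sum (t ∷ ts) ≡ m → CanonicalForm F
extendFirstBlock {m} x l t ts σ rest new x≢◌ sorted total = record
  { loops    = l
  ; sizes    = suc t ∷ ts
  ; sorted   = sorted
  ; size-sum = trans (ℕ.+-suc l (t + sum ts)) (cong suc total)
  ; perm     = insert x slot σ
  ; similar  = ∼-insert {G = canonical l (suc t ∷ ts)} x slot σ rest
                        (listColouring-punchIn l (just (length ts)) (blocks (t ∷ ts)) l<m)
                        (λ k → ⇔.trans (new k) (mk⇔ (trans G-slot) (trans (sym G-slot))))
                        (mk⇔ (⊥-elim ∘ x≢◌) (λ G-slot≡◌ → ⊥-elim (just≢nothing (trans (sym G-slot) G-slot≡◌))))
  }
  where
  l<m : l < suc m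
  l<m = s≤s (ℕ.≤-trans (ℕ.m≤m+n l (sum (t ∷ ts))) (ℕ.≤-reflexive total))
  slot : Fin (suc m)
  slot = fromℕ< l<m
  G-slot : canonical l (suc t ∷ ts) slot ≡ just (length ts)
  G-slot = listColouring-at l (just (length ts)) (blocks (t ∷ ts)) l<m

extendByNewClass : ∀ {F : Colouring (suc m)} x → F x ≢ nothing → (∀ k → F (punchIn x k) ≢ F x) →
                   CanonicalForm (F ∘ punchIn x) → CanonicalForm F
extendByNewClass {F = F} x x≢◌ fresh form =
  extendFirstBlock x loops 0 sizes perm similar new x≢◌ (ℕ.≤-refl ∷ sorted) size-sum
  where
  open CanonicalForm form
  new : ∀ k → F x ≡ F (punchIn x k) ⇔ just (length sizes) ≡ canonical loops sizes (perm ⟨$⟩ʳ k)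
  new k = mk⇔ (⊥-elim ∘ fresh k ∘ sym)
              (λ eq → ⊥-elim (ℕ.<-irrefl refl (blocks-colour< sizes (canonical-∈⁻ loops sizes (sym eq)))))

module SmallestClass {m} {F : Colouring (suc m)} (x : Fin (suc m)) (x≢◌ : F x ≢ nothing)
  (minimal : ∀ z → count F (F x) ≤ count F (F z)) (y₀ : Fin m) (y₀∈x : F (punchIn x y₀) ≡ F x)
  (l t : ℕ) (ts : List ℕ) (σ : Permutation′ m) (sorted : Linked _≤_ (1 ∷ suc t ∷ ts))
  (total : l + sum (suc t ∷ ts) ≡ m) (rest : (F ∘ punchIn x) ∼ (canonical l (suc t ∷ ts) ∘ (σ ⟨$⟩ʳ_)))
  where

  size₀ : ℕ
  size₀ = suc t

  G : Colouring m
  G = canonical l (size₀ ∷ ts)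

  c₀ : Maybe ℕ
  c₀ = just (length ts)

  count-G : ∀ c → count G (just c) ≡ countᴸ (just c) (blocks (size₀ ∷ ts))
  count-G = count-canonical l (size₀ ∷ ts) total

  restCount : ∀ k → count (F ∘ punchIn x) (F (punchIn x k)) ≡ count G (G (σ ⟨$⟩ʳ k))
  restCount k = trans (∼-count rest k) (count-permute G σ _)

  otherCount : ∀ k → F (punchIn x k) ≢ F x → count F (F (punchIn x k)) ≡ count G (G (σ ⟨$⟩ʳ k))
  otherCount k k∉x = trans (count-punchIn F x _)
    (cong₂ _+_ (cong 𝟙 (dec-false (F x ≟ᶜ F (punchIn x k)) (k∉x ∘ sym))) (restCount k))

  xCount : count F (F x) ≡ suc (count G (G (σ ⟨$⟩ʳ y₀)))
  xCount = trans (count-punchIn F x (F x))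
    (cong₂ _+_ (cong 𝟙 (dec-true (F x ≟ᶜ F x) refl)) (trans (cong (count (F ∘ punchIn x)) (sym y₀∈x)) (restCount y₀)))

  size₀≤count : ∀ q → G q ≢ nothing → size₀ ≤ count G (G q)
  size₀≤count q Gq≢◌ with G q in Gq
  ... | nothing = ⊥-elim (Gq≢◌ refl)
  ... | just c rewrite count-G c =
    All.lookup (Linked⇒All ℕ.≤-trans ℕ.≤-refl (Linked.tail sorted))
               (countᴸ-blocks-∈ (size₀ ∷ ts) (canonical-∈⁻ l (size₀ ∷ ts) Gq))

  position : ∀ {c} → just c ∈ₗ blocks (size₀ ∷ ts) → ∃ λ z → G (σ ⟨$⟩ʳ z) ≡ just c
  position c∈ = let q , Gq = canonical-∈⁺ l (size₀ ∷ ts) total c∈ in σ ⟨$⟩ˡ q , trans (cong G (inverseʳ σ)) Gq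

  -- by minimality of x's class, it is the class placed in the first block
  y₀-first : G (σ ⟨$⟩ʳ y₀) ≡ c₀
  y₀-first with position {length ts} (here refl)
  ... | z , Gz with F (punchIn x z) ≟ᶜ F x
  ...   | yes z∈x = trans (Equivalence.to (_∼_.sameColour rest y₀ z) (trans y₀∈x (sym z∈x))) Gz
  ...   | no z∉x = ⊥-elim (ℕ.<-irrefl refl (begin
    suc size₀                        ≤⟨ s≤s (size₀≤count (σ ⟨$⟩ʳ y₀) y₀≢◌) ⟩
    suc (count G (G (σ ⟨$⟩ʳ y₀)))    ≡⟨ xCount ⟨
    count F (F x)                    ≤⟨ minimal (punchIn x z) ⟩
    count F (F (punchIn x z))        ≡⟨ otherCount z z∉x ⟩
    count G (G (σ ⟨$⟩ʳ z))           ≡⟨ cong (count G) Gz ⟩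
    count G c₀                       ≡⟨ count-G (length ts) ⟩
    countᴸ c₀ (blocks (size₀ ∷ ts))  ≡⟨ countᴸ-blocks-head size₀ ts ⟩
    size₀                            ∎))
    where
    open ℕ.≤-Reasoning
    y₀≢◌ : G (σ ⟨$⟩ʳ y₀) ≢ nothing
    y₀≢◌ = x≢◌ ∘ trans (sym y₀∈x) ∘ Equivalence.from (_∼_.sameLoops rest y₀)

  xCount≡ : count F (F x) ≡ suc size₀
  xCount≡ = trans xCount
    (cong suc (trans (cong (count G) y₀-first) (trans (count-G (length ts)) (countᴸ-blocks-head size₀ ts))))

  larger : ∀ {c} → just c ∈ₗ blocks ts → suc size₀ ≤ countᴸ (just c) (blocks ts)
  larger {c} c∈ with position (∈-++⁺ʳ (replicate size₀ c₀) c∈)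
  ... | z , Gz = begin
    suc size₀                              ≡⟨ xCount≡ ⟨
    count F (F x)                          ≤⟨ minimal (punchIn x z) ⟩
    count F (F (punchIn x z))              ≡⟨ otherCount z z∉x ⟩
    count G (G (σ ⟨$⟩ʳ z))                 ≡⟨ cong (count G) Gz ⟩
    count G (just c)                       ≡⟨ count-G c ⟩
    countᴸ (just c) (blocks (size₀ ∷ ts))  ≡⟨ countᴸ-blocks-tail size₀ ts c<ts ⟩
    countᴸ (just c) (blocks ts)            ∎
    where
    open ℕ.≤-Reasoning
    c<ts : c < length ts
    c<ts = blocks-colour< ts c∈
    z∉x : F (punchIn x z) ≢ F x
    z∉x z∈x = ℕ.<⇒≢ c<ts (just-injective
      (trans (sym Gz) (trans (Equivalence.to (_∼_.sameColour rest z y₀) (trans z∈x (sym y₀∈x))) y₀-first)))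

  new : ∀ k → F x ≡ F (punchIn x k) ⇔ c₀ ≡ G (σ ⟨$⟩ʳ k)
  new k = mk⇔ (λ x∼k → trans (sym y₀-first) (Equivalence.to (_∼_.sameColour rest y₀ k) (trans y₀∈x x∼k)))
              (λ c₀≡ → trans (sym y₀∈x) (Equivalence.from (_∼_.sameColour rest y₀ k) (trans y₀-first c₀≡)))

canonical-[] : ∀ l (q : Fin m) → canonical l [] q ≡ nothing
canonical-[] l q with canonical l [] q in eq
... | nothing = refl
... | just c with () ← canonical-∈⁻ l [] eq

extendSorted : ∀ {t ts} → Linked _≤_ (suc t ∷ ts) →
               (∀ {c} → just c ∈ₗ blocks ts → suc (suc t) ≤ countᴸ (just c) (blocks ts)) →
               Linked _≤_ (suc (suc t) ∷ ts)
extendSorted [-] _ = [-]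
extendSorted {t} {suc b ∷ ts} (s≤s _ ∷ sorted) larger =
  subst (suc (suc t) ≤_) (countᴸ-blocks-head (suc b) ts) (larger (here refl)) ∷ sorted

extendBySmallestClass : ∀ {F : Colouring (suc m)} x → F x ≢ nothing → (∀ z → count F (F x) ≤ count F (F z)) →
                        ∀ y₀ → F (punchIn x y₀) ≡ F x → CanonicalForm (F ∘ punchIn x) → CanonicalForm F
extendBySmallestClass x x≢◌ _ y₀ y₀∈x record { loops = l ; sizes = [] ; similar = rest } =
  ⊥-elim (x≢◌ (trans (sym y₀∈x) (Equivalence.from (_∼_.sameLoops rest y₀) (canonical-[] l _))))
extendBySmallestClass x x≢◌ _ _ _ record { sizes = zero ∷ _ ; sorted = () ∷ _ }
extendBySmallestClass {F = F} x x≢◌ minimal y₀ y₀∈x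
  record { loops = l ; sizes = suc t ∷ ts ; sorted = sorted@(_ ∷ sorted′) ; size-sum = total
         ; perm = σ ; similar = rest } =
  extendFirstBlock x l (suc t) ts σ rest new x≢◌ (s≤s z≤n ∷ extendSorted sorted′ larger) total
  where open SmallestClass {F = F} x x≢◌ minimal y₀ y₀∈x l t ts σ sorted total rest

smallestClass : ∀ (F : Colouring (suc m)) → ∃ λ x → ∀ z → count F (F x) ≤ count F (F z)
smallestClass {m} F =
  argmin size zero (allFin (suc m)) , λ z → All.lookup (f[argmin]≤f[xs] {f = size} zero (allFin (suc m))) (∈-allFin z)
  where
  size : Fin (suc m) → ℕ
  size z = count F (F z)

canonicalForm : ∀ (F : Colouring m) → CanonicalForm F
canonicalForm {zero} F = record
  { loops = 0 ; sizes = [] ; sorted = [-] ; size-sum = refl ; perm = Perm.id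
  ; similar = record { sameColour = λ () ; sameLoops = λ () }
  }
canonicalForm {suc m} F with any? (λ x → F x ≟ᶜ nothing)
... | yes (x , x∈◌) = extendByLoop x x∈◌ (canonicalForm (F ∘ punchIn x))
... | no noLoop = fromSmallestClass (smallestClass F)
  where
  fromSmallestClass : (∃ λ x → ∀ z → count F (F x) ≤ count F (F z)) → CanonicalForm F
  fromSmallestClass (x , minimal) with any? (λ k → F (punchIn x k) ≟ᶜ F x)
  ... | yes (y₀ , y₀∈x) =
    extendBySmallestClass x (noLoop ∘ (x ,_)) minimal y₀ y₀∈x (canonicalForm (F ∘ punchIn x))
  ... | no fresh = extendByNewClass x (noLoop ∘ (x ,_)) (λ k → fresh ∘ (k ,_)) (canonicalForm (F ∘ punchIn x))

-- Uniqueness of canonical forms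

occurrences : ℕ → List ℕ → ℕ
occurrences t [] = 0
occurrences t (b ∷ bs) = 𝟙 (does (b ℕ.≟ t)) + occurrences t bs

occurrences-head : ∀ a bs → occurrences a (a ∷ bs) ≡ suc (occurrences a bs)
occurrences-head a bs rewrite dec-true (a ℕ.≟ a) refl = refl

occurrences-below : ∀ {a b bs} → Linked _≤_ (b ∷ bs) → a < b → occurrences a (b ∷ bs) ≡ 0
occurrences-below {a} {b} {bs} sorted a<b = go (Linked⇒All ℕ.≤-trans ℕ.≤-refl sorted)
  where
  go : ∀ {cs} → All (b ≤_) cs → occurrences a cs ≡ 0
  go [] = refl
  go {c ∷ _} (b≤c ∷ rest) rewrite dec-false (c ℕ.≟ a) (ℕ.>⇒≢ (ℕ.<-≤-trans a<b b≤c)) = go rest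

sorted-≡ : ∀ {as bs} → Linked _≤_ as → Linked _≤_ bs → (∀ t → occurrences t as ≡ occurrences t bs) → as ≡ bs
sorted-≡ {[]} {[]} _ _ _ = refl
sorted-≡ {[]} {b ∷ bs} _ _ same with () ← trans (same b) (occurrences-head b bs)
sorted-≡ {a ∷ as} {[]} _ _ same with () ← trans (sym (same a)) (occurrences-head a as)
sorted-≡ {a ∷ as} {b ∷ bs} sa sb same with ℕ.<-cmp a b
... | tri< a<b _ _ with () ← trans (sym (occurrences-head a as)) (trans (same a) (occurrences-below sb a<b))
... | tri> _ _ b<a with () ← trans (sym (occurrences-head b bs)) (trans (sym (same b)) (occurrences-below sa b<a))
... | tri≈ _ refl _ =
  cong (a ∷_) (sorted-≡ (Linked.tail sa) (Linked.tail sb) λ t → ℕ.+-cancelˡ-≡ _ _ _ (same t))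

ClassOfSize : Colouring m → ℕ → Fin m → Set
ClassOfSize F t x = F x ≢ nothing × count F (F x) ≡ t

classOfSize? : ∀ (F : Colouring m) t x → Dec (ClassOfSize F t x)
classOfSize? F t x = ¬? (F x ≟ᶜ nothing) ×-dec count F (F x) ℕ.≟ t

profile : Colouring m → ℕ → ℕ
profile F t = ∑ λ x → 𝟙 (does (classOfSize? F t x))

∼-profile : ∀ {F G : Colouring m} (σ : Permutation′ m) → F ∼ (G ∘ (σ ⟨$⟩ʳ_)) → ∀ t → profile F t ≡ profile G t
∼-profile {F = F} {G} σ F∼Gσ t = begin
  profile F t                                        ≡⟨ sum-cong-≗ (λ x → cong 𝟙 (does-⇔ (same x) (classOfSize? F t x)
                                                                                     (classOfSize? G t (σ ⟨$⟩ʳ x)))) ⟩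
  ∑ (λ x → 𝟙 (does (classOfSize? G t (σ ⟨$⟩ʳ x))))  ≡⟨ sum-permute (λ y → 𝟙 (does (classOfSize? G t y))) σ ⟨
  profile G t                                        ∎
  where
  open ≡-Reasoning
  sizes≡ : ∀ x → count F (F x) ≡ count G (G (σ ⟨$⟩ʳ x))
  sizes≡ x = trans (∼-count F∼Gσ x) (count-permute G σ _)
  same : ∀ x → ClassOfSize F t x ⇔ ClassOfSize G t (σ ⟨$⟩ʳ x)
  same x = mk⇔ (λ (x≢◌ , size) → x≢◌ ∘ Equivalence.from (_∼_.sameLoops F∼Gσ x) , trans (sym (sizes≡ x)) size)
               (λ (x≢◌ , size) → x≢◌ ∘ Equivalence.to (_∼_.sameLoops F∼Gσ x) , trans (sizes≡ x) size)

∑-listColouring : ∀ (g : Maybe ℕ → ℕ) L → length L ≡ m → ∑ (g ∘ listColouring {m} L) ≡ sum (map g L)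
∑-listColouring g [] refl = refl
∑-listColouring g (a ∷ L) refl = cong (g a +_) (∑-listColouring g L refl)

sum-map-++ : ∀ (g : Maybe ℕ → ℕ) A B → sum (map g (A ++ B)) ≡ sum (map g A) + sum (map g B)
sum-map-++ g A B = trans (cong sum (map-++ g A B)) (sum-++ (map g A) (map g B))

sum-map-replicate : ∀ (g : Maybe ℕ → ℕ) n a → sum (map g (replicate n a)) ≡ n * g a
sum-map-replicate g zero a = refl
sum-map-replicate g (suc n) a = cong (g a +_) (sum-map-replicate g n a)

inClassOfSize : List (Maybe ℕ) → ℕ → Maybe ℕ → ℕ
inClassOfSize L t v = 𝟙 (does (¬? (v ≟ᶜ nothing) ×-dec countᴸ v L ℕ.≟ t))

n*[n≡t] : ∀ n t → n * 𝟙 (does (n ℕ.≟ t)) ≡ t * 𝟙 (does (n ℕ.≟ t))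
n*[n≡t] n t with n ℕ.≟ t
... | yes refl = refl
... | no n≢t rewrite dec-false (n ℕ.≟ t) n≢t = trans (ℕ.*-zeroʳ n) (sym (ℕ.*-zeroʳ t))

blocks-profile : ∀ L t ts → (∀ {c} → just c ∈ₗ blocks ts → countᴸ (just c) L ≡ countᴸ (just c) (blocks ts)) →
                 sum (map (inClassOfSize L t) (blocks ts)) ≡ t * occurrences t ts
blocks-profile L t [] _ = sym (ℕ.*-zeroʳ t)
blocks-profile L t (b ∷ ts) inherit = begin
  sum (map h (replicate b c₀ ++ blocks ts))               ≡⟨ sum-map-++ h (replicate b c₀) (blocks ts) ⟩
  sum (map h (replicate b c₀)) + sum (map h (blocks ts))  ≡⟨ cong₂ _+_ (sum-map-replicate h b c₀)
                                                                       (blocks-profile L t ts inherit′) ⟩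
  b * h c₀ + t * occurrences t ts                         ≡⟨ cong (_+ t * occurrences t ts)
                                                                  (trans (firstBlock b inherit) (n*[n≡t] b t)) ⟩
  t * 𝟙 (does (b ℕ.≟ t)) + t * occurrences t ts           ≡⟨ ℕ.*-distribˡ-+ t _ _ ⟨
  t * occurrences t (b ∷ ts)                              ∎
  where
  open ≡-Reasoning
  h : Maybe ℕ → ℕ
  h = inClassOfSize L t
  c₀ : Maybe ℕ
  c₀ = just (length ts)
  firstBlock : ∀ b → (∀ {c} → just c ∈ₗ blocks (b ∷ ts) → countᴸ (just c) L ≡ countᴸ (just c) (blocks (b ∷ ts))) →
               b * h c₀ ≡ b * 𝟙 (does (b ℕ.≟ t))
  firstBlock zero _ = refl
  firstBlock (suc b) inherit =
    cong (λ n → suc b * 𝟙 (does (n ℕ.≟ t))) (trans (inherit (here refl)) (countᴸ-blocks-head (suc b) ts))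
  inherit′ : ∀ {c} → just c ∈ₗ blocks ts → countᴸ (just c) L ≡ countᴸ (just c) (blocks ts)
  inherit′ c∈ = trans (inherit (∈-++⁺ʳ (replicate b c₀) c∈)) (countᴸ-blocks-tail b ts (blocks-colour< ts c∈))

profile-canonical : ∀ l ts → l + sum ts ≡ m → ∀ t → profile (canonical {m} l ts) t ≡ t * occurrences t ts
profile-canonical {m} l ts total t = begin
  profile G t                                        ≡⟨ sum-cong-≗ (λ x → cong (λ n → 𝟙 (does (¬? (G x ≟ᶜ nothing) ×-dec n ℕ.≟ t)))
                                                                              (count-listColouring L len (G x))) ⟩
  ∑ (h ∘ G)                                          ≡⟨ ∑-listColouring h L len ⟩
  sum (map h (replicate l nothing ++ blocks ts))     ≡⟨ sum-map-++ h (replicate l nothing) (blocks ts) ⟩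
  sum (map h (replicate l nothing)) + sum (map h (blocks ts))
                                                     ≡⟨ cong₂ _+_ (trans (sum-map-replicate h l nothing) (ℕ.*-zeroʳ l))
                                                                  (blocks-profile L t ts λ {c} _ → countᴸ-layout l ts c) ⟩
  t * occurrences t ts                               ∎
  where
  open ≡-Reasoning
  L : List (Maybe ℕ)
  L = layout l ts
  G : Colouring m
  G = canonical l ts
  h : Maybe ℕ → ℕ
  h = inClassOfSize L t
  len : length L ≡ m
  len = trans (length-layout l ts) total

canonical-unique : ∀ {l ts l′ ts′} → Linked _≤_ (1 ∷ ts) → Linked _≤_ (1 ∷ ts′) →
                   l + sum ts ≡ m → l′ + sum ts′ ≡ m →
                   (σ : Permutation′ m) → canonical l ts ∼ (canonical l′ ts′ ∘ (σ ⟨$⟩ʳ_)) → l ≡ l′ × ts ≡ ts′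
canonical-unique {m} {l} {ts} {l′} {ts′} sorted sorted′ total total′ σ similar =
  loops≡ , sorted-≡ (Linked.tail sorted) (Linked.tail sorted′) occurrences≡
  where
  open ≡-Reasoning
  loops≡ : l ≡ l′
  loops≡ = begin
    l                                                ≡⟨ count-canonical-loops l ts total ⟨
    count (canonical {m} l ts) nothing               ≡⟨ ∼-countLoops similar ⟩
    count (canonical {m} l′ ts′ ∘ (σ ⟨$⟩ʳ_)) nothing  ≡⟨ count-permute (canonical l′ ts′) σ nothing ⟩
    count (canonical {m} l′ ts′) nothing             ≡⟨ count-canonical-loops l′ ts′ total′ ⟩
    l′                                               ∎
  occurrences≡ : ∀ t → occurrences t ts ≡ occurrences t ts′
  occurrences≡ zero = trans (noZeros sorted) (sym (noZeros sorted′))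
    where
    noZeros : ∀ {us} → Linked _≤_ (1 ∷ us) → occurrences 0 us ≡ 0
    noZeros [-] = refl
    noZeros (1≤u ∷ sorted) = occurrences-below sorted 1≤u
  occurrences≡ t@(suc _) = ℕ.*-cancelˡ-≡ _ _ t (begin
    t * occurrences t ts              ≡⟨ profile-canonical l ts total t ⟨
    profile (canonical {m} l ts) t    ≡⟨ ∼-profile {G = canonical l′ ts′} σ similar t ⟩
    profile (canonical {m} l′ ts′) t  ≡⟨ profile-canonical l′ ts′ total′ t ⟩
    t * occurrences t ts′             ∎)

-- Partitions

IsPartition : ℕ → ℕ → List ℕ → Set
IsPartition lo n xs = Linked _≤_ (lo ∷ xs) × sum xs ≡ n

isPartition? : ∀ lo n xs → Dec (IsPartition lo n xs)
isPartition? lo n xs = linked? ℕ._≤?_ (lo ∷ xs) ×-dec sum xs ℕ.≟ n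

words : List ℕ → ℕ → List (List ℕ)
words as zero = [] ∷ []
words as (suc n) = [] ∷ cartesianProductWith _∷_ as (words as n)

∈-words : ∀ as n {xs} → length xs ≤ n → All (_∈ₗ as) xs → xs ∈ₗ words as n
∈-words as zero {[]} _ _ = here refl
∈-words as (suc n) {[]} _ _ = here refl
∈-words as (suc n) {x ∷ xs} (s≤s len≤n) (x∈ ∷ xs∈) =
  there (∈-cartesianProductWith⁺ _∷_ x∈ (∈-words as n len≤n xs∈))

words-unique : ∀ {as} → Unique as → ∀ n → Unique (words as n)
words-unique uas zero = [] ∷ []
words-unique {as} uas (suc n) =
  All.tabulate nonEmpty ∷ Unique.cartesianProductWith⁺ _∷_ ∷-injective uas (words-unique uas n)
  where
  nonEmpty : ∀ {ys} → ys ∈ₗ cartesianProductWith _∷_ as (words as n) → [] ≢ ys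
  nonEmpty ys∈ []≡ys with ∈-cartesianProductWith⁻ _∷_ as (words as n) ys∈
  ... | _ , _ , _ , _ , refl with () ← []≡ys

partitions : ℕ → ℕ → List (List ℕ)
partitions lo n = filter (isPartition? lo n) (words (upTo (suc n)) n)

∈-partitions⁻ : ∀ lo n {xs} → xs ∈ₗ partitions lo n → IsPartition lo n xs
∈-partitions⁻ lo n xs∈ = proj₂ (∈-filter⁻ (isPartition? lo n) {xs = words (upTo (suc n)) n} xs∈)

∈-partitions⁺ : ∀ {lo n xs} → 1 ≤ lo → IsPartition lo n xs → xs ∈ₗ partitions lo n
∈-partitions⁺ {lo} {n} {xs} 1≤lo xs∈@(sorted , total) = ∈-filter⁺ (isPartition? lo n)
  (∈-words (upTo (suc n)) n (subst (length xs ≤_) total (length≤sum (All.map (ℕ.≤-trans 1≤lo) (linked-≥ sorted))))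
             (All.map (λ x≤ → ∈-upTo⁺ (s≤s (subst (_ ≤_) total x≤))) (part≤sum xs)))
  xs∈
  where
  length≤sum : ∀ {ys} → All (1 ≤_) ys → length ys ≤ sum ys
  length≤sum [] = z≤n
  length≤sum {y ∷ ys} (1≤y ∷ 1≤ys) = ℕ.+-mono-≤ 1≤y (length≤sum 1≤ys)
  part≤sum : ∀ ys → All (_≤ sum ys) ys
  part≤sum [] = []
  part≤sum (y ∷ ys) =
    ℕ.m≤m+n y (sum ys) ∷ All.map (λ y′≤ → ℕ.≤-trans y′≤ (ℕ.m≤n+m (sum ys) y)) (part≤sum ys)

partitions-unique : ∀ lo n → Unique (partitions lo n)
partitions-unique lo n = Unique.filter⁺ (isPartition? lo n) (words-unique (Unique.upTo⁺ (suc n)) n)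

multiPartitions : ℕ → ℕ → List (List ℕ)
multiPartitions lo n = filter (λ xs → 2 ℕ.≤? length xs) (partitions lo n)

multiPartitions-unique : ∀ lo n → Unique (multiPartitions lo n)
multiPartitions-unique lo n = Unique.filter⁺ (λ xs → 2 ℕ.≤? length xs) (partitions-unique lo n)

∈-multiPartitions⁻ : ∀ lo n {xs} → xs ∈ₗ multiPartitions lo n → xs ∈ₗ partitions lo n × 2 ≤ length xs
∈-multiPartitions⁻ lo n = ∈-filter⁻ (λ xs → 2 ℕ.≤? length xs) {xs = partitions lo n}

∈-multiPartitions⁺ : ∀ lo n {xs} → xs ∈ₗ partitions lo n → 2 ≤ length xs → xs ∈ₗ multiPartitions lo n
∈-multiPartitions⁺ lo n = ∈-filter⁺ (λ xs → 2 ℕ.≤? length xs)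

length-partitions : ∀ lo k → 1 ≤ lo → lo ≤ k → length (partitions lo k) ≡ suc (length (multiPartitions lo k))
length-partitions lo k 1≤lo lo≤k = unique-length-≡ (partitions-unique lo k) unique to from
  where
  unique : Unique ((k ∷ []) ∷ multiPartitions lo k)
  unique = All.tabulate (λ xs∈ k≡xs → ℕ.<⇒≱ (proj₂ (∈-multiPartitions⁻ lo k xs∈)) (ℕ.≤-reflexive (cong length (sym k≡xs))))
         ∷ multiPartitions-unique lo k
  to : ∀ {xs} → xs ∈ₗ partitions lo k → xs ∈ₗ (k ∷ []) ∷ multiPartitions lo k
  to {[]} xs∈ = ⊥-elim (ℕ.<⇒≱ (ℕ.≤-trans 1≤lo lo≤k) (ℕ.≤-reflexive (sym (proj₂ (∈-partitions⁻ lo k xs∈)))))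
  to {x ∷ []} xs∈ = here (cong (_∷ []) (trans (sym (ℕ.+-identityʳ x)) (proj₂ (∈-partitions⁻ lo k xs∈))))
  to {x ∷ y ∷ xs} xs∈ = there (∈-multiPartitions⁺ lo k xs∈ (s≤s (s≤s z≤n)))
  from : ∀ {xs} → xs ∈ₗ (k ∷ []) ∷ multiPartitions lo k → xs ∈ₗ partitions lo k
  from (here refl) = ∈-partitions⁺ 1≤lo (lo≤k ∷ [-] , ℕ.+-identityʳ k)
  from (there xs∈) = proj₁ (∈-multiPartitions⁻ lo k xs∈)

length-multiPartitions : ∀ n → 1 ≤ n →
  length (multiPartitions 1 (suc n)) ≡ length (partitions 1 n) + length (multiPartitions 2 (suc n))
length-multiPartitions n 1≤n = begin
  length (multiPartitions 1 (suc n))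
    ≡⟨ unique-length-≡ (multiPartitions-unique 1 (suc n)) unique to from ⟩
  length (map (1 ∷_) (partitions 1 n) ++ multiPartitions 2 (suc n))
    ≡⟨ length-++ (map (1 ∷_) (partitions 1 n)) ⟩
  length (map (1 ∷_) (partitions 1 n)) + length (multiPartitions 2 (suc n))
    ≡⟨ cong (_+ length (multiPartitions 2 (suc n))) (length-map (1 ∷_) (partitions 1 n)) ⟩
  length (partitions 1 n) + length (multiPartitions 2 (suc n))
    ∎
  where
  open ≡-Reasoning
  unique : Unique (map (1 ∷_) (partitions 1 n) ++ multiPartitions 2 (suc n))
  unique = Unique.++⁺ (Unique.map⁺ (proj₂ ∘ ∷-injective) (partitions-unique 1 n)) (multiPartitions-unique 2 (suc n))
                      disjoint
    where
    disjoint : ∀ {xs} → xs ∈ₗ map (1 ∷_) (partitions 1 n) × xs ∈ₗ multiPartitions 2 (suc n) → ⊥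
    disjoint (xs∈₁ , xs∈₂) with ∈-map⁻ (1 ∷_) xs∈₁
    ... | _ , _ , refl with ∈-partitions⁻ 2 (suc n) (proj₁ (∈-multiPartitions⁻ 2 (suc n) xs∈₂))
    ...   | s≤s () ∷ _ , _
  to : ∀ {xs} → xs ∈ₗ multiPartitions 1 (suc n) → xs ∈ₗ map (1 ∷_) (partitions 1 n) ++ multiPartitions 2 (suc n)
  to {[]} xs∈ with () ← proj₂ (∈-multiPartitions⁻ 1 (suc n) xs∈)
  to {_ ∷ []} xs∈ with s≤s () ← proj₂ (∈-multiPartitions⁻ 1 (suc n) xs∈)
  to {x ∷ y ∷ ys} xs∈ with ∈-partitions⁻ 1 (suc n) (proj₁ (∈-multiPartitions⁻ 1 (suc n) xs∈))
  to {zero ∷ y ∷ ys} xs∈ | () ∷ _ , _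
  to {suc zero ∷ y ∷ ys} xs∈ | _ ∷ sorted , total =
    ∈-++⁺ˡ (∈-map⁺ (1 ∷_) (∈-partitions⁺ ℕ.≤-refl (sorted , ℕ.suc-injective total)))
  to {suc (suc x) ∷ y ∷ ys} xs∈ | _ ∷ sorted , total = ∈-++⁺ʳ (map (1 ∷_) (partitions 1 n))
    (∈-multiPartitions⁺ 2 (suc n) (∈-partitions⁺ (s≤s z≤n) (s≤s (s≤s z≤n) ∷ sorted , total)) (s≤s (s≤s z≤n)))
  from : ∀ {xs} → xs ∈ₗ map (1 ∷_) (partitions 1 n) ++ multiPartitions 2 (suc n) → xs ∈ₗ multiPartitions 1 (suc n)
  from xs∈ with ∈-++⁻ (map (1 ∷_) (partitions 1 n)) xs∈
  ... | inj₁ xs∈₁ with ∈-map⁻ (1 ∷_) xs∈₁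
  ...   | y ∷ ys , ys∈ , refl =
    let sorted , total = ∈-partitions⁻ 1 n ys∈
    in  ∈-multiPartitions⁺ 1 (suc n) (∈-partitions⁺ ℕ.≤-refl (ℕ.≤-refl ∷ sorted , cong suc total)) (s≤s (s≤s z≤n))
  ...   | [] , ys∈ , refl = ⊥-elim (ℕ.<⇒≱ 1≤n (ℕ.≤-reflexive (sym (proj₂ (∈-partitions⁻ 1 n ys∈)))))
  from xs∈ | inj₂ xs∈₂ with ∈-multiPartitions⁻ 2 (suc n) xs∈₂
  ... | xs∈′ , 2≤len with ∈-partitions⁻ 2 (suc n) xs∈′
  ...   | 2≤x ∷ sorted , total =
    ∈-multiPartitions⁺ 1 (suc n) (∈-partitions⁺ ℕ.≤-refl (ℕ.≤-trans (s≤s z≤n) 2≤x ∷ sorted , total)) 2≤len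

linked⇒nonIncreasing : ∀ {xs} → Linked _≥_ xs → NonIncreasing xs
linked⇒nonIncreasing [] = []
linked⇒nonIncreasing [-] = [ _ ]
linked⇒nonIncreasing (x≥y ∷ sorted) = x≥y ∷ linked⇒nonIncreasing sorted

nonIncreasing⇒linked : ∀ {xs} → NonIncreasing xs → Linked _≥_ xs
nonIncreasing⇒linked [] = []
nonIncreasing⇒linked [ _ ] = [-]
nonIncreasing⇒linked (x≥y ∷ sorted) = x≥y ∷ nonIncreasing⇒linked sorted

reverse-isPartition≥2 : ∀ {n xs} → IsPartition 2 n xs → IsPartition≥2 n (reverse xs)
reverse-isPartition≥2 {xs = xs} (sorted , total) =
  linked⇒nonIncreasing (linked-reverse ℕ.≤-trans (Linked.tail sorted)) ,
  All-resp-↭ (↭-sym (↭-reverse xs)) (linked-≥ sorted) ,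
  trans (sum-↭ (↭-reverse xs)) total

reverse-isPartition : ∀ {n ys} → IsPartition≥2 n ys → IsPartition 2 n (reverse ys)
reverse-isPartition {ys = ys} (nonIncreasing , parts , total) =
  linked-∷ (All-resp-↭ (↭-sym (↭-reverse ys)) parts)
           (linked-reverse (flip ℕ.≤-trans) (nonIncreasing⇒linked nonIncreasing)) ,
  trans (sum-↭ (↭-reverse ys)) total

length-partitions≥2 : ∀ n P → IsPartition≥2Enum n P → length (partitions 2 n) ≡ length P
length-partitions≥2 n P (uniqueP , soundP , completeP) =
  trans (sym (length-map reverse (partitions 2 n)))
        (unique-length-≡ (Unique.map⁺ reverse-injective (partitions-unique 2 n)) uniqueP to from)
  where
  to : ∀ {ys} → ys ∈ₗ map reverse (partitions 2 n) → ys ∈ₗ P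
  to ys∈ with ∈-map⁻ reverse ys∈
  ... | xs , xs∈ , refl = completeP (reverse xs) (reverse-isPartition≥2 (∈-partitions⁻ 2 n xs∈))
  from : ∀ {ys} → ys ∈ₗ P → ys ∈ₗ map reverse (partitions 2 n)
  from {ys} ys∈ = subst (_∈ₗ map reverse (partitions 2 n)) (reverse-involutive ys)
    (∈-map⁺ reverse (∈-partitions⁺ (s≤s z≤n) (reverse-isPartition (soundP ys ys∈))))

partition-recurrence : ∀ n P → IsPartition≥2Enum (2 + n) P →
  length (multiPartitions 1 (2 + n)) ≡ length (multiPartitions 1 (1 + n)) + length P
partition-recurrence n P enumP = begin
  length (multiPartitions 1 (2 + n))               ≡⟨ length-multiPartitions (suc n) (s≤s z≤n) ⟩
  length (partitions 1 (1 + n)) + r                ≡⟨ cong (_+ r) (length-partitions 1 (suc n) ℕ.≤-refl (s≤s z≤n)) ⟩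
  suc q + r                                        ≡⟨ ℕ.+-suc q r ⟨
  q + suc r                                        ≡⟨ cong (q +_) (length-partitions 2 (2 + n) (s≤s z≤n) (s≤s (s≤s z≤n))) ⟨
  q + length (partitions 2 (2 + n))                ≡⟨ cong (q +_) (length-partitions≥2 (2 + n) P enumP) ⟩
  q + length P                                     ∎
  where
  open ≡-Reasoning
  q r : ℕ
  q = length (multiPartitions 1 (1 + n))
  r = length (multiPartitions 2 (2 + n))

-- Counting isomorphism classes of rank-2 matroids

-- the number of loops and the sizes of the parallel classes
Shape : Set
Shape = ℕ × List ℕ

IsShape : ℕ → Shape → Set
IsShape m (l , ts) = Linked _≤_ (1 ∷ ts) × 2 ≤ length ts × l + sum ts ≡ m

loopless : List ℕ → Shape
loopless ts = 0 , ts

withLoop : Shape → Shape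
withLoop (l , ts) = suc l , ts

shapes : ℕ → List Shape
shapes zero = map loopless (multiPartitions 1 0)
shapes (suc m) = map loopless (multiPartitions 1 (suc m)) ++ map withLoop (shapes m)

length-shapes : ∀ m → length (shapes (suc m)) ≡ length (multiPartitions 1 (suc m)) + length (shapes m)
length-shapes m = trans (length-++ (map loopless (multiPartitions 1 (suc m))))
  (cong₂ _+_ (length-map loopless (multiPartitions 1 (suc m))) (length-map withLoop (shapes m)))

loopless-isShape : ∀ {m ts} → ts ∈ₗ multiPartitions 1 m → IsShape m (0 , ts)
loopless-isShape {m} ts∈ with ∈-multiPartitions⁻ 1 m ts∈
... | ts∈′ , 2≤len = let sorted , total = ∈-partitions⁻ 1 m ts∈′ in sorted , 2≤len , total

∈-shapes⁻ : ∀ m {s} → s ∈ₗ shapes m → IsShape m s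
∈-shapes⁻ zero s∈ with ∈-map⁻ loopless s∈
... | _ , ts∈ , refl = loopless-isShape ts∈
∈-shapes⁻ (suc m) s∈ with ∈-++⁻ (map loopless (multiPartitions 1 (suc m))) s∈
... | inj₁ s∈₀ with ∈-map⁻ loopless s∈₀
...   | _ , ts∈ , refl = loopless-isShape ts∈
∈-shapes⁻ (suc m) s∈ | inj₂ s∈₊ with ∈-map⁻ withLoop s∈₊
... | _ , s∈′ , refl with ∈-shapes⁻ m s∈′
...   | sorted , 2≤len , total = sorted , 2≤len , cong suc total

∈-shapes⁺ : ∀ m {l ts} → IsShape m (l , ts) → (l , ts) ∈ₗ shapes m
∈-shapes⁺ zero {zero} (sorted , 2≤len , total) =
  ∈-map⁺ loopless (∈-multiPartitions⁺ 1 0 (∈-partitions⁺ ℕ.≤-refl (sorted , total)) 2≤len)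
∈-shapes⁺ (suc m) {zero} (sorted , 2≤len , total) =
  ∈-++⁺ˡ (∈-map⁺ loopless (∈-multiPartitions⁺ 1 (suc m) (∈-partitions⁺ ℕ.≤-refl (sorted , total)) 2≤len))
∈-shapes⁺ (suc m) {suc l} (sorted , 2≤len , total) = ∈-++⁺ʳ (map loopless (multiPartitions 1 (suc m)))
  (∈-map⁺ withLoop (∈-shapes⁺ m (sorted , 2≤len , ℕ.suc-injective total)))

shapes-unique : ∀ m → Unique (shapes m)
shapes-unique zero = Unique.map⁺ {f = loopless} (cong proj₂) (multiPartitions-unique 1 0)
shapes-unique (suc m) = Unique.++⁺ (Unique.map⁺ {f = loopless} (cong proj₂) (multiPartitions-unique 1 (suc m)))
  (Unique.map⁺ {f = withLoop} withLoop-injective (shapes-unique m)) disjoint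
  where
  withLoop-injective : ∀ {s s′ : Shape} → withLoop s ≡ withLoop s′ → s ≡ s′
  withLoop-injective {_ , _} {_ , _} refl = refl
  disjoint : ∀ {s} → s ∈ₗ map loopless (multiPartitions 1 (suc m)) × s ∈ₗ map withLoop (shapes m) → ⊥
  disjoint (s∈₀ , s∈₊) with ∈-map⁻ loopless s∈₀ | ∈-map⁻ withLoop s∈₊
  ... | _ , _ , refl | _ , _ , ()

canonical-twoColoured : ∀ {l ts} → IsShape m (l , ts) → TwoColoured (canonical {m} l ts)
canonical-twoColoured {l = l} {suc a ∷ suc b ∷ ts} (_ , _ , total) =
  let x , Gx = canonical-∈⁺ l (suc a ∷ suc b ∷ ts) total (here refl)
      y , Gy = canonical-∈⁺ l (suc a ∷ suc b ∷ ts) total (∈-++⁺ʳ (replicate (suc a) _) (here refl))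
  in  x , y , distinct (just≢nothing ∘ trans (sym Gx)) (just≢nothing ∘ trans (sym Gy))
                       (λ eq → ℕ.1+n≢n (just-injective (trans (sym Gx) (trans eq Gy))))
canonical-twoColoured {ts = []} (_ , () , _)
canonical-twoColoured {ts = _ ∷ []} (_ , s≤s () , _)
canonical-twoColoured {ts = zero ∷ _} (() ∷ _ , _)
canonical-twoColoured {ts = suc _ ∷ zero ∷ _} (_ ∷ () ∷ _ , _)

twoColoured⇒2≤length : ∀ {l ts} → TwoColoured (canonical {m} l ts) → 2 ≤ length ts
twoColoured⇒2≤length {l = l} {ts} (x , y , distinct x≢◌ y≢◌ c≢) with canonical l ts x in Gx | canonical l ts y in Gy
... | nothing | _ = ⊥-elim (x≢◌ refl)
... | just _ | nothing = ⊥-elim (y≢◌ refl)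
... | just c | just d = twoValues (colour< Gx) (colour< Gy) (c≢ ∘ cong just)
  where
  colour< : ∀ {z c} → canonical l ts z ≡ just c → c < length ts
  colour< Gz = blocks-colour< ts (canonical-∈⁻ l ts Gz)
  twoValues : ∀ {c d n} → c < n → d < n → c ≢ d → 2 ≤ n
  twoValues {zero} {zero} _ _ c≢d = ⊥-elim (c≢d refl)
  twoValues {suc _} (s≤s (s≤s _)) _ _ = s≤s (s≤s z≤n)
  twoValues {_} {suc _} _ (s≤s (s≤s _)) _ = s≤s (s≤s z≤n)

canonicalMatroid : ∀ s → .(IsShape m s) → Matroid m
canonicalMatroid (l , ts) shape = colourMatroid (canonical l ts) (canonical-twoColoured shape)

HasShape : Matroid m → Shape → Set
HasShape {m} M s = Σ (IsShape m s) λ shape → Isomorphic M (canonicalMatroid s shape)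

shape-exists : ∀ {M : Matroid m} → HasRank 2 M → ∃ (HasShape M)
shape-exists {m} {M} rank₂ = (loops , sizes) , shape ,
  basisPair⇒isomorphic {M = M} {N = canonicalMatroid (loops , sizes) shape}
                       rank₂ (colourMatroid-rank G (canonical-twoColoured shape)) perm pairs
  where
  open RankTwo M rank₂
  open CanonicalForm (canonicalForm colour)
  G : Colouring m
  G = canonical loops sizes
  twoG : TwoColoured G
  twoG with colour-twoColoured
  ... | x , y , xy =
    perm ⟨$⟩ʳ x , perm ⟨$⟩ʳ y , Equivalence.to (distinctColours-∘ (perm ⟨$⟩ʳ_)) (∼-distinctColours similar xy)
  shape : IsShape m (loops , sizes)
  shape = sorted , twoColoured⇒2≤length {l = loops} {sizes} twoG , size-sum
  pairs : ∀ x y → basisPair M x y ≡ basisPair (canonicalMatroid (loops , sizes) shape) (perm ⟨$⟩ʳ x) (perm ⟨$⟩ʳ y)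
  pairs x y = trans (basisPair≡distinctColours x y)
              (trans (∼⇒does-distinctColours {G = G} perm similar x y)
                     (sym (colourMatroid-basisPair G (canonical-twoColoured shape) (perm ⟨$⟩ʳ x) (perm ⟨$⟩ʳ y))))

shape-unique : ∀ {M : Matroid m} {s s′} → HasShape M s → HasShape M s′ → s ≡ s′
shape-unique {M = M} {l , ts} {l′ , ts′} (shape@(sorted , _ , total) , iso) (shape′@(sorted′ , _ , total′) , iso′)
  with colourMatroid-isomorphic⇒∼ (canonical-twoColoured shape) (canonical-twoColoured shape′)
         (isomorphic-trans {M = canonicalMatroid (l , ts) shape} {N = M} {O = canonicalMatroid (l′ , ts′) shape′}
                           (isomorphic-sym {M = M} {N = canonicalMatroid (l , ts) shape} iso) iso′)
... | σ , similar with canonical-unique sorted sorted′ total total′ σ similar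
...   | refl , refl = refl

classCount : ∀ {L : List (Matroid m)} → IsRank2ClassReps m L → length L ≡ length (shapes m)
classCount {m} {L} (rank₂ , nonIsomorphic , complete) =
  length-≡ HasShape disjoint (shapes-unique m) shapeOf representative (λ {M} → shape-unique {M = M})
  where
  disjoint : AllPairs (λ M N → ∀ {s} → HasShape M s → HasShape N s → ⊥) L
  disjoint = AllPairs.map (λ {M} {N} M≇N {s} (shape , M≅C) (_ , N≅C) →
    M≇N (isomorphic-trans {M = M} {N = canonicalMatroid s shape} {O = N} M≅C
                          (isomorphic-sym {M = N} {N = canonicalMatroid s shape} N≅C)))
    nonIsomorphic
  shapeOf : ∀ {M} → M ∈ₗ L → ∃ λ s → s ∈ₗ shapes m × HasShape M s
  shapeOf {M} M∈ =
    Product.map₂ (λ hasShape → ∈-shapes⁺ m (proj₁ hasShape) , hasShape) (shape-exists {M = M} (All.lookup rank₂ M∈))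
  representative : ∀ {s} → s ∈ₗ shapes m → ∃ λ M → M ∈ₗ L × HasShape M s
  representative {s} s∈ =
    let M , M∈ , C≅M = find (complete (canonicalMatroid s shape)
                                      (colourMatroid-rank (canonical (proj₁ s) (proj₂ s)) (canonical-twoColoured shape)))
    in  M , M∈ , shape , isomorphic-sym {M = canonicalMatroid s shape} {N = M} C≅M
    where
    shape : IsShape m s
    shape = ∈-shapes⁻ m s∈

-- only n ≥ 2 is needed
theorem3p4 : (n : ℕ) → 4 ≤ n →
    (Ln : List (Matroid n)) → IsRank2ClassReps n Ln →
    (Ln-1 : List (Matroid (n Data.Nat.∸ 1))) → IsRank2ClassReps (n Data.Nat.∸ 1) Ln-1 →
    (Ln-2 : List (Matroid (n Data.Nat.∸ 2))) → IsRank2ClassReps (n Data.Nat.∸ 2) Ln-2 →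
    (P : List (List ℕ)) → IsPartition≥2Enum n P →
    length Ln + length Ln-2 ≡ 2 * length Ln-1 + length P
theorem3p4 (suc (suc n)) _ Ln reps Ln-1 reps-1 Ln-2 reps-2 P enumP = begin
  length Ln + length Ln-2                      ≡⟨ cong₂ _+_ (classCount reps) (classCount reps-2) ⟩
  length (shapes (2 + n)) + length (shapes n)  ≡⟨ cong (_+ s) (trans (length-shapes (suc n))
                                                      (cong₂ _+_ (partition-recurrence n P enumP) (length-shapes n))) ⟩
  (q + ρ) + (q + s) + s                        ≡⟨ solve 3 (λ q ρ s → (q :+ ρ) :+ (q :+ s) :+ s := con 2 :* (q :+ s) :+ ρ)
                                                        refl q ρ s ⟩
  2 * (q + s) + ρ                              ≡⟨ cong (λ k → 2 * k + ρ) (trans (classCount reps-1) (length-shapes n)) ⟨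
  2 * length Ln-1 + length P                   ∎
  where
  open ≡-Reasoning
  open +-*-Solver
  q s ρ : ℕ
  q = length (multiPartitions 1 (1 + n))
  s = length (shapes n)
  ρ = length P
theorem3p4 1 (s≤s ())
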